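{- Let $l$ and $m$ be fixed integers with $l>m\ge 0$. Let $f(x)=(a_1x+b_1)(a_2x+b_2)$, where $a_1,a_2,b_1,b_2$ are positive integers with $\gcd(a_1,b_1)=\gcd(a_2,b_2)=1$ and $a_1b_2\ne a_2b_1$, and let $q=\mathrm{lcm}(a_1,a_2)$. For each integer $r'$ with $1\le r'\le q$ and $\gcd(r',q)=1$, let $r$ be the unique integer with $1\le r\le q$ and $rr'\equiv 1\pmod q$, set for $j=1,2$ $$H_j:=\Big\lfloor\frac{a_jl-(l-m)\langle b_jr\rangle_{a_j}}{a_j(l-m)}\Big\rfloor,$$ and for each positive integer $n$ let $\mathcal{P}_{r'}=\mathcal{P}_{r'}(n)$ be the set of primes $p$ with $p\equiv r'\pmod q$ and $$p\in \big(0,(l-m)n\big]\ \cup\ \bigcup_{j=1}^2\bigcup_{i=0}^{H_j}\Big(\frac{a_jmn}{\langle b_jr\rangle_{a_j}+a_ji},\ \frac{a_jln}{\langle b_jr\rangle_{a_j}+a_ji}\Big].$$ Then, as the positive integer $n\to\infty$, $$\log \mathrm{lcm}_{mn<i\le ln}\{ f(i)\}=\sum_{\substack{r'=1\\ \gcd(r',q)=1}}^{q}\ \sum_{p\in \mathcal{P}_{r'}}\log p+O\big(\sqrt{n}\big).$$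
   Context: For positive integers $a$ and $b$, $\langle b\rangle_a$ denotes the unique integer in $\{1,2,\dots,a\}$ congruent to $b$ modulo $a$; $\lfloor\cdot\rfloor$ is the floor function. -}

module Defs where

open import Data.Nat.Base
open import Data.Nat.DivMod using (_%_; _/_)
open import Data.Nat.LCM using (lcm)
open import Data.Nat.Primality using (prime?)
open import Data.Bool.Base using (Bool; true; false; _∧_; _∨_; if_then_else_)
open import Data.List.Base using (List; applyUpTo; foldr; filter; length; map)
open import Data.Bool.ListAction using (any)
open import Relation.Nullary.Decidable using (⌊_⌋)
open import Data.Nat.Properties using (_≤?_)
open import Relation.Unary using (Decidable)

-- b mod a (for a > 0); the a = 0 case is never used.
modN : ℕ → ℕ → ℕ
modN zero    b = b
modN (suc k) b = b % suc k

-- floor division (for a > 0); the a = 0 case is never used.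
divN : ℕ → ℕ → ℕ
divN zero    b = 0
divN (suc k) b = b / suc k

-- ⟨ b ⟩_a : the unique integer in {1,…,a} congruent to b modulo a.
angle : ℕ → ℕ → ℕ
angle a b = if modN a b ≡ᵇ 0 then a else modN a b

range : ℕ → ℕ → List ℕ
range lo hi = applyUpTo (λ k → lo + suc k) (hi ∸ lo)

isqrt : ℕ → ℕ
isqrt n = length (filter (λ s → s * s ≤? n) (applyUpTo suc n))

-- r : the unique integer in {1,…,q} with r r' ≡ 1 (mod q)
-- (found by search; it exists and is unique when gcd(r',q) = 1).
invMod : ℕ → ℕ → ℕ
invMod q r' = go (applyUpTo suc q)
  where
  go : List ℕ → ℕ
  go List.[] = 0
  go (r List.∷ rs) = if modN q (r * r') ≡ᵇ modN q 1 then r else go rs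

f : ℕ → ℕ → ℕ → ℕ → ℕ → ℕ
f a1 b1 a2 b2 x = (a1 * x + b1) * (a2 * x + b2)

lcmF : ℕ → ℕ → ℕ → ℕ → ℕ → ℕ → ℕ → ℕ
lcmF l m a1 b1 a2 b2 n = foldr lcm 1 (map (f a1 b1 a2 b2) (range (m * n) (l * n)))

-- H_j = ⌊ (a l − (l−m) c) / (a (l−m)) ⌋ with c = ⟨ b r ⟩_a;
-- the numerator is ≥ a m ≥ 0 since c ≤ a, so truncated subtraction is exact.
H : ℕ → ℕ → ℕ → ℕ → ℕ → ℕ
H l m a b r = divN (a * (l ∸ m)) (a * l ∸ (l ∸ m) * angle a (b * r))

-- p ∈ ( a m n / (c + a i) , a l n / (c + a i) ]  with c = ⟨ b r ⟩_a (denominator > 0)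
inPiece : ℕ → ℕ → ℕ → ℕ → ℕ → ℕ → ℕ → ℕ → Bool
inPiece l m a b r n p i =
  let D = angle a (b * r) + a * i in
  (a * m * n <ᵇ p * D) ∧ (p * D ≤ᵇ a * l * n)

inUnion : ℕ → ℕ → ℕ → ℕ → ℕ → ℕ → ℕ → ℕ → ℕ → Bool
inUnion l m a1 b1 a2 b2 r n p =
  ((0 <ᵇ p) ∧ (p ≤ᵇ (l ∸ m) * n))
  ∨ any (inPiece l m a1 b1 r n p) (applyUpTo (λ i → i) (suc (H l m a1 b1 r)))
  ∨ any (inPiece l m a2 b2 r n p) (applyUpTo (λ i → i) (suc (H l m a2 b2 r)))

inP : ℕ → ℕ → ℕ → ℕ → ℕ → ℕ → ℕ → ℕ → ℕ → Bool
inP l m a1 b1 a2 b2 n r' p =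
  let q = lcm a1 a2 in
  ⌊ prime? p ⌋ ∧ (modN q p ≡ᵇ modN q r') ∧ inUnion l m a1 b1 a2 b2 (invMod q r') n p

-- Every element of 𝒫_{r'}(n) is ≤ a l n / ⟨…⟩ ≤ (a1 + a2) l n + (l−m) n; we enumerate up to that bound.
bound : ℕ → ℕ → ℕ → ℕ → ℕ → ℕ
bound l m a1 a2 n = (a1 + a2) * l * n + (l ∸ m) * n

-- ∏_{r'=1, gcd(r',q)=1}^{q} ∏_{p ∈ 𝒫_{r'}} p   ( = exp of the double sum of log p )
primeProd : ℕ → ℕ → ℕ → ℕ → ℕ → ℕ → ℕ → ℕ
primeProd l m a1 b1 a2 b2 n =
  let q = lcm a1 a2 in
  foldr _*_ 1 (map (λ r' →
     foldr _*_ 1 (filter (λ p → T? (inP l m a1 b1 a2 b2 n r' p)) (applyUpTo suc (bound l m a1 a2 n))))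
   (filter (λ r' → T? (Data.Nat.GCD.gcd r' q ≡ᵇ 1)) (applyUpTo suc q)))
  where
  open import Relation.Nullary.Decidable using (T?)
  import Data.Nat.GCD

-- Let L = lcm_{mn<i≤ln} f(i) and P the product of the primes of the sets 𝒫_{r′}.
-- Every p ∈ 𝒫_{r′} divides a value aⱼ i + bⱼ with mn − (b₁ + b₂) < i ≤ ln: if p ≤ (l − m) n because aⱼ is
-- invertible modulo p, and if p lies in a piece (aⱼ m n/(c + aⱼ t), aⱼ l n/(c + aⱼ t)], c = ⟨bⱼ r⟩, because
-- p (c + aⱼ t) ≡ bⱼ (mod aⱼ).  Hence P divides L times boundedly many values f(i) = O(n²).
-- Conversely take Y ≍ √n.  A prime p > Y divides each f(i) at most once and only one of its linear factors
-- (it exceeds a₁b₂ − a₂b₁).  Writing aⱼ i + bⱼ = p k, one has k ≡ ⟨bⱼ r⟩ (mod aⱼ) where r′ ≡ p and r r′ ≡ 1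
-- (mod q), so p lies in a piece of 𝒫_{r′} unless p k > aⱼ l n, and then p divides one of the boundedly many
-- numbers aⱼ l n + u, u ≤ bⱼ.  The primes p ≤ Y contribute at most ∏_{p ≤ Y} p^⌊log_p Z⌋ with Z = O(n²),
-- which is e^{O(Y)} by Chebyshev's bound on the primorial.  Both directions thus lose a factor e^{O(√n)}.

module Submission where

open import Defs
open import Data.Bool.Base using (Bool; true; false; T; _∧_; if_then_else_)
open import Data.Bool.ListAction using (any)
open import Data.Bool.Properties using (T-∧; T-∨)
open import Data.Empty using (⊥; ⊥-elim)
open import Data.List.Base using (List; []; _∷_; _++_; map; filter; applyUpTo; length; foldr)
open import Data.List.Properties using (map-++; map-id)
open import Data.List.Membership.Propositional using (_∈_; lose)
open import Data.List.Membership.Propositional.Properties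
  using (∈-map⁺; ∈-map⁻; ∈-applyUpTo⁺)
open import Data.List.Relation.Unary.Any using (here; there; satisfied)
open import Data.List.Relation.Unary.Any.Properties using (any⁺; any⁻)
open import Data.Nat.Base
open import Data.Nat.Properties
open import Data.Nat.Divisibility
open import Data.Nat.DivMod
open import Data.Nat.GCD using (gcd; module Bézout)
open import Data.Nat.LCM using (lcm; m∣lcm[m,n]; n∣lcm[m,n]; lcm-least; gcd*lcm)
open import Data.Nat.Coprimality as Coprimality
  using (Coprime; coprime⇒gcd≡1; gcd≡1⇒coprime; coprime-divisor; coprime-Bézout; prime⇒coprime)
open import Data.Nat.Primality using (Prime; prime?; euclidsLemma; prime⇒irreducible; prime⇒nonTrivial; prime⇒nonZero; ¬prime[1])
open import Data.Nat.Primality.Factorisation using (factorise)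
open import Data.List.Relation.Unary.All using (_∷_)
open import Induction.WellFounded using (Acc; acc)
open import Data.Nat.Induction using (<-wellFounded)
open import Data.Nat.Combinatorics using (_C_; nCk+nC[k+1]≡[n+1]C[k+1]; nCk≡n!/k![n-k]!; k![n∸k]!∣n!)
open import Data.Nat.ListAction using (product)
open import Data.Nat.ListAction.Properties using (∈⇒∣product; product-++)
open import Data.Nat.Tactic.RingSolver using (solve-∀)
open import Data.Product using (∃; ∃-syntax; _×_; _,_; proj₁; proj₂)
open import Data.Sum using (_⊎_; inj₁; inj₂)
import Data.Sum as Sum
open import Relation.Binary.Definitions using (tri<; tri≈; tri>)
open import Data.Unit using (tt)
open import Function using (_∘_; case_of_)
open import Function.Bundles using (Equivalence)
open Equivalence using (to; from)
open import Relation.Nullary using (¬_; Dec; yes; no; does)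
open import Relation.Nullary.Decidable using (T?; ⌊_⌋; toWitness; fromWitness)
open import Relation.Binary.PropositionalEquality
open import Algebra.Properties.CommutativeSemigroup *-commutativeSemigroup
  using (interchange; xy∙z≈xz∙y)

-- Products and least common multiples of lists

m*n>0 : ∀ {m n} → 0 < m → 0 < n → 0 < m * n
m*n>0 {suc _} {suc _} _ _ = z<s

product-map-cong : ∀ {A : Set} {f g : A → ℕ} xs → (∀ x → f x ≡ g x) → product (map f xs) ≡ product (map g xs)
product-map-cong []       eq = refl
product-map-cong (x ∷ xs) eq = cong₂ _*_ (eq x) (product-map-cong xs eq)

product-map-1 : ∀ {A : Set} (xs : List A) → product (map (λ _ → 1) xs) ≡ 1
product-map-1 []       = refl
product-map-1 (x ∷ xs) = trans (+-identityʳ _) (product-map-1 xs)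

product-map-* : ∀ {A : Set} (f g : A → ℕ) xs →
  product (map (λ x → f x * g x) xs) ≡ product (map f xs) * product (map g xs)
product-map-* f g []       = refl
product-map-* f g (x ∷ xs) = begin
  f x * g x * product (map (λ y → f y * g y) xs)
    ≡⟨ cong (f x * g x *_) (product-map-* f g xs) ⟩
  f x * g x * (product (map f xs) * product (map g xs))
    ≡⟨ interchange (f x) (g x) _ _ ⟩
  f x * product (map f xs) * (g x * product (map g xs)) ∎
  where open ≡-Reasoning

^-distrib-* : ∀ a b n → (a * b) ^ n ≡ a ^ n * b ^ n
^-distrib-* a b zero    = refl
^-distrib-* a b (suc n) = trans (cong (a * b *_) (^-distrib-* a b n)) (interchange a b (a ^ n) (b ^ n))

product-map-^ : ∀ (f : ℕ → ℕ) k xs → product (map (λ x → f x ^ k) xs) ≡ product (map f xs) ^ k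
product-map-^ f k []       = sym (^-zeroˡ k)
product-map-^ f k (x ∷ xs) =
  trans (cong (f x ^ k *_) (product-map-^ f k xs)) (sym (^-distrib-* (f x) (product (map f xs)) k))

product-map-swap : ∀ {A B : Set} (F : A → B → ℕ) (xs : List A) (ys : List B) →
  product (map (λ x → product (map (F x) ys)) xs) ≡ product (map (λ y → product (map (λ x → F x y) xs)) ys)
product-map-swap F []       ys = sym (product-map-1 ys)
product-map-swap F (x ∷ xs) ys =
  trans (cong (product (map (F x) ys) *_) (product-map-swap F xs ys))
        (sym (product-map-* (F x) (λ y → product (map (λ x′ → F x′ y) xs)) ys))

product-map-filter : ∀ {A : Set} (P : A → Bool) (f : A → ℕ) xs →
  product (map f (filter (T? ∘ P) xs)) ≡ product (map (λ x → if P x then f x else 1) xs)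
product-map-filter P f []       = refl
product-map-filter P f (x ∷ xs) with P x
... | true  = cong (f x *_) (product-map-filter P f xs)
... | false = trans (product-map-filter P f xs) (sym (+-identityʳ _))

product-map-mono-≤ : ∀ {A : Set} {f g : A → ℕ} xs → (∀ {x} → x ∈ xs → f x ≤ g x) →
  product (map f xs) ≤ product (map g xs)
product-map-mono-≤ []       le = ≤-refl
product-map-mono-≤ (x ∷ xs) le = *-mono-≤ (le (here refl)) (product-map-mono-≤ xs (le ∘ there))

product-map-≤-^ : ∀ {A : Set} (f : A → ℕ) c xs → (∀ {x} → x ∈ xs → f x ≤ c) →
  product (map f xs) ≤ c ^ length xs
product-map-≤-^ f c []       le = ≤-refl
product-map-≤-^ f c (x ∷ xs) le = *-mono-≤ (le (here refl)) (product-map-≤-^ f c xs (le ∘ there))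

product-map-pos : ∀ {A : Set} (f : A → ℕ) xs → (∀ {x} → x ∈ xs → 0 < f x) → 0 < product (map f xs)
product-map-pos f []       pos = z<s
product-map-pos f (x ∷ xs) pos = m*n>0 (pos (here refl)) (product-map-pos f xs (pos ∘ there))

prime∣product : ∀ {p} xs → Prime p → p ∣ product xs → ∃[ x ] x ∈ xs × p ∣ x
prime∣product []       pp p∣1 = ⊥-elim (¬prime[1] (subst Prime (∣1⇒≡1 p∣1) pp))
prime∣product (y ∷ xs) pp p∣yxs with euclidsLemma y (product xs) pp p∣yxs
... | inj₁ p∣y  = y , here refl , p∣y
... | inj₂ p∣xs with prime∣product xs pp p∣xs
...   | x , x∈xs , p∣x = x , there x∈xs , p∣x

lcm≢0 : ∀ m n .{{_ : NonZero m}} .{{_ : NonZero n}} → NonZero (lcm m n)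
lcm≢0 m n = ≢-nonZero λ lcm≡0 → ≢-nonZero⁻¹ (m * n) {{m*n≢0 m n}}
  (trans (sym (gcd*lcm m n)) (trans (cong (gcd m n *_) lcm≡0) (*-zeroʳ (gcd m n))))

lcmList : List ℕ → ℕ
lcmList = foldr lcm 1

∈⇒∣lcmList : ∀ {x xs} → x ∈ xs → x ∣ lcmList xs
∈⇒∣lcmList {x} {_ ∷ xs} (here refl)  = m∣lcm[m,n] x (lcmList xs)
∈⇒∣lcmList {x} {y ∷ xs} (there x∈xs) = ∣-trans (∈⇒∣lcmList x∈xs) (n∣lcm[m,n] y (lcmList xs))

lcmList-least : ∀ {M} xs → (∀ {x} → x ∈ xs → x ∣ M) → lcmList xs ∣ M
lcmList-least []       all∣ = 1∣ _
lcmList-least (x ∷ xs) all∣ = lcm-least (all∣ (here refl)) (lcmList-least xs (all∣ ∘ there))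

lcmList>0 : ∀ xs → (∀ {x} → x ∈ xs → 0 < x) → 0 < lcmList xs
lcmList>0 []       _   = z<s
lcmList>0 (x ∷ xs) pos = >-nonZero⁻¹ (lcm x (lcmList xs))
  {{lcm≢0 x (lcmList xs) {{>-nonZero (pos (here refl))}} {{>-nonZero (lcmList>0 xs (pos ∘ there))}}}}

interval : ℕ → ℕ → List ℕ
interval a zero    = []
interval a (suc j) = suc a ∷ interval (suc a) j

applyUpTo-cong : ∀ {f g : ℕ → ℕ} j → (∀ k → f k ≡ g k) → applyUpTo f j ≡ applyUpTo g j
applyUpTo-cong zero    eq = refl
applyUpTo-cong (suc j) eq = cong₂ _∷_ (eq 0) (applyUpTo-cong j (eq ∘ suc))

applyUpTo≡interval : ∀ a j → applyUpTo (λ k → a + suc k) j ≡ interval a j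
applyUpTo≡interval a zero    = refl
applyUpTo≡interval a (suc j) = cong₂ _∷_ (+-comm a 1)
  (trans (applyUpTo-cong j (λ k → +-suc a (suc k))) (applyUpTo≡interval (suc a) j))

range≡interval : ∀ lo hi → range lo hi ≡ interval lo (hi ∸ lo)
range≡interval lo hi = applyUpTo≡interval lo (hi ∸ lo)

∈-interval⁻ : ∀ {a j x} → x ∈ interval a j → a < x × x ≤ a + j
∈-interval⁻ {a} {suc j} (here refl) = ≤-refl , subst (suc a ≤_) (sym (+-suc a j)) (s≤s (m≤m+n a j))
∈-interval⁻ {a} {suc j} {x} (there x∈) with ∈-interval⁻ x∈
... | a<x , x≤ = <⇒≤ a<x , subst (x ≤_) (sym (+-suc a j)) x≤

∈-interval⁺ : ∀ {a j x} → a < x → x ≤ a + j → x ∈ interval a j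
∈-interval⁺ {a} {zero}  {x} a<x x≤ = ⊥-elim (<⇒≱ a<x (subst (x ≤_) (+-identityʳ a) x≤))
∈-interval⁺ {a} {suc j} {x} a<x x≤ with m≤n⇒m<n∨m≡n a<x
... | inj₂ refl = here refl
... | inj₁ a+1<x = there (∈-interval⁺ a+1<x (subst (x ≤_) (+-suc a j) x≤))

length-interval : ∀ a j → length (interval a j) ≡ j
length-interval a zero    = refl
length-interval a (suc j) = cong suc (length-interval (suc a) j)

interval-++ : ∀ a j k → interval a (j + k) ≡ interval a j ++ interval (a + j) k
interval-++ a zero    k = cong (λ b → interval b k) (sym (+-identityʳ a))
interval-++ a (suc j) k = cong (suc a ∷_)
  (trans (interval-++ (suc a) j k) (cong (λ b → interval (suc a) j ++ interval b k) (sym (+-suc a j))))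

product-map-interval-+ : ∀ (g : ℕ → ℕ) a j k →
  product (map g (interval a (j + k))) ≡ product (map g (interval a j)) * product (map g (interval (a + j) k))
product-map-interval-+ g a j k = begin
  product (map g (interval a (j + k)))                              ≡⟨ cong (product ∘ map g) (interval-++ a j k) ⟩
  product (map g (interval a j ++ interval (a + j) k))              ≡⟨ cong product (map-++ g (interval a j) _) ⟩
  product (map g (interval a j) ++ map g (interval (a + j) k))      ≡⟨ product-++ (map g (interval a j)) _ ⟩
  product (map g (interval a j)) * product (map g (interval (a + j) k)) ∎
  where open ≡-Reasoning

product-map-if-false : ∀ (P : ℕ → Bool) p xs → (∀ {x} → x ∈ xs → ¬ T (P x)) →
  product (map (λ x → if P x then p else 1) xs) ≡ 1
product-map-if-false P p []       _   = refl
product-map-if-false P p (x ∷ xs) ¬Px with P x in Px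
... | true  = ⊥-elim (¬Px (here refl) (subst T (sym Px) tt))
... | false = trans (+-identityʳ _) (product-map-if-false P p xs (¬Px ∘ there))

product-map-if-unique : ∀ (P : ℕ → Bool) p a j →
  (∀ {x y} → x ∈ interval a j → y ∈ interval a j → T (P x) → T (P y) → x ≡ y) →
  let w = product (map (λ x → if P x then p else 1) (interval a j)) in
  w ≡ 1 ⊎ (w ≡ p × ∃[ x ] x ∈ interval a j × T (P x))
product-map-if-unique P p a zero    _    = inj₁ refl
product-map-if-unique P p a (suc j) uniq with P (suc a) in Pa
... | true  = inj₂ (trans (cong (p *_) rest≡1) (*-identityʳ p) , suc a , here refl , subst T (sym Pa) tt)
  where
  rest≡1 = product-map-if-false P p (interval (suc a) j) λ {y} y∈ Py →
    <-irrefl (uniq (here refl) (there y∈) (subst T (sym Pa) tt) Py) (proj₁ (∈-interval⁻ y∈))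
... | false with product-map-if-unique P p (suc a) j (λ x∈ y∈ → uniq (there x∈) (there y∈))
...   | inj₁ w≡1 = inj₁ (trans (+-identityʳ _) w≡1)
...   | inj₂ (w≡p , x , x∈ , Px) = inj₂ (trans (+-identityʳ _) w≡p , x , there x∈ , Px)

product-filter-swap : ∀ (sel : ℕ → Bool) (inb : ℕ → ℕ → Bool) R U →
  product (map (λ r → product (filter (T? ∘ inb r) U)) (filter (T? ∘ sel) R))
    ≡ product (map (λ p → product (map (λ r → if sel r ∧ inb r p then p else 1) R)) U)
product-filter-swap sel inb R U = begin
  product (map (λ r → product (filter (T? ∘ inb r) U)) (filter (T? ∘ sel) R))
    ≡⟨ product-map-filter sel (λ r → product (filter (T? ∘ inb r) U)) R ⟩
  product (map (λ r → if sel r then product (filter (T? ∘ inb r) U) else 1) R)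
    ≡⟨ product-map-cong R select ⟩
  product (map (λ r → product (map (λ p → if sel r ∧ inb r p then p else 1) U)) R)
    ≡⟨ product-map-swap (λ r p → if sel r ∧ inb r p then p else 1) R U ⟩
  product (map (λ p → product (map (λ r → if sel r ∧ inb r p then p else 1) R)) U) ∎
  where
  open ≡-Reasoning
  select : ∀ r → (if sel r then product (filter (T? ∘ inb r) U) else 1)
                   ≡ product (map (λ p → if sel r ∧ inb r p then p else 1) U)
  select r with sel r
  ... | true  = trans (cong product (sym (map-id (filter (T? ∘ inb r) U)))) (product-map-filter (inb r) (λ p → p) U)
  ... | false = sym (product-map-1 U)

-- Primes, coprimality and divisibility

prime>1 : ∀ {p} → Prime p → 1 < p
prime>1 {p} pp = nonTrivial⇒n>1 p {{prime⇒nonTrivial pp}}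

prime∤⇒coprime : ∀ {p y} → Prime p → ¬ p ∣ y → Coprime p y
prime∤⇒coprime pp p∤y (d∣p , d∣y) with prime⇒irreducible pp d∣p
... | inj₁ d≡1 = d≡1
... | inj₂ refl = ⊥-elim (p∤y d∣y)

coprime-*ˡ : ∀ {a b c} → Coprime a c → Coprime b c → Coprime (a * b) c
coprime-*ˡ a⊥c b⊥c (d∣ab , d∣c) =
  b⊥c (coprime-divisor (Coprimality.sym (λ (e∣a , e∣d) → a⊥c (e∣a , ∣-trans e∣d d∣c))) d∣ab , d∣c)

coprime-^ˡ : ∀ {p y} e → Coprime p y → Coprime (p ^ e) y
coprime-^ˡ zero    p⊥y (d∣1 , _) = ∣1⇒≡1 d∣1
coprime-^ˡ (suc e) p⊥y = coprime-*ˡ p⊥y (coprime-^ˡ e p⊥y)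

coprime-∣ʳ : ∀ {a b c} → Coprime a b → c ∣ b → Coprime a c
coprime-∣ʳ a⊥b c∣b (d∣a , d∣c) = a⊥b (d∣a , ∣-trans d∣c c∣b)

coprime-*-∣ : ∀ {a b M} → Coprime a b → a ∣ M → b ∣ M → a * b ∣ M
coprime-*-∣ {a} {b} a⊥b a∣M b∣M = subst (_∣ _) lcm≡* (lcm-least a∣M b∣M)
  where
  lcm≡* : lcm a b ≡ a * b
  lcm≡* = trans (sym (*-identityˡ (lcm a b)))
                (trans (cong (_* lcm a b) (sym (coprime⇒gcd≡1 a⊥b))) (gcd*lcm a b))

^-monoʳ-∣ : ∀ p {k e} → k ≤ e → p ^ k ∣ p ^ e
^-monoʳ-∣ p {k} {e} k≤e = divides (p ^ (e ∸ k))
  (trans (cong (p ^_) (sym (m+[n∸m]≡n k≤e))) (trans (^-distribˡ-+-* p k (e ∸ k)) (*-comm (p ^ k) (p ^ (e ∸ k)))))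

prime-factor : ∀ x → 1 < x → ∃[ p ] Prime p × p ∣ x
prime-factor x@(suc _) 1<x with factorise x
... | record { factors = [] ; isFactorisation = x≡1 } = ⊥-elim (<-irrefl (sym x≡1) 1<x)
... | record { factors = p ∷ ps ; isFactorisation = x≡∏ ; factorsPrime = pp ∷ _ } =
  p , pp , subst (p ∣_) (sym x≡∏) (∈⇒∣product {ns = p ∷ ps} (here refl))

prime-power-decomposition : ∀ {p} → Prime p → ∀ x → 0 < x → ∃[ e ] ∃[ y ] x ≡ p ^ e * y × ¬ p ∣ y
prime-power-decomposition {p} pp x = go x (<-wellFounded x)
  where
  go : ∀ x → Acc _<_ x → 0 < x → ∃[ e ] ∃[ y ] x ≡ p ^ e * y × ¬ p ∣ y
  go x (acc rec) x>0 with p ∣? x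
  ... | no  p∤x = 0 , x , sym (+-identityʳ x) , p∤x
  ... | yes (divides zero    refl) = ⊥-elim (<-irrefl refl x>0)
  ... | yes (divides (suc k) refl) with go (suc k) (rec (m<m*n (suc k) p (prime>1 pp))) z<s
  ...   | e , y , k+1≡ , p∤y = suc e , y , eq , p∤y
    where
    eq : suc k * p ≡ p ^ suc e * y
    eq = trans (*-comm (suc k) p) (trans (cong (p *_) k+1≡) (sym (*-assoc p (p ^ e) y)))

∣-by-prime-powers : ∀ x M → 0 < x → (∀ p k → Prime p → p ^ k ∣ x → p ^ k ∣ M) → x ∣ M
∣-by-prime-powers x M = go x (<-wellFounded x)
  where
  go : ∀ x → Acc _<_ x → 0 < x → (∀ p k → Prime p → p ^ k ∣ x → p ^ k ∣ M) → x ∣ M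
  go 1 _ _ _ = 1∣ M
  go x@(2+ _) (acc rec) x>0 pk∣M with prime-factor x (s<s z<s)
  ... | p , pp , p∣x with prime-power-decomposition pp x x>0
  ...   | zero  , y , x≡y  , p∤y = ⊥-elim (p∤y (subst (p ∣_) (trans x≡y (+-identityʳ y)) p∣x))
  ...   | suc e , y , x≡pe*y , p∤y =
    subst (_∣ M) (sym x≡pe*y) (coprime-*-∣ (coprime-^ˡ (suc e) (prime∤⇒coprime pp p∤y)) (pk∣M p (suc e) pp pe∣x) y∣M)
    where
    pe∣x : p ^ suc e ∣ x
    pe∣x = divides y (trans x≡pe*y (*-comm (p ^ suc e) y))
    y∣x : y ∣ x
    y∣x = divides (p ^ suc e) x≡pe*y
    y>0 : 0 < y
    y>0 = n≢0⇒n>0 λ { refl → <-irrefl (sym (trans x≡pe*y (*-zeroʳ (p ^ suc e)))) x>0 }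
    pe>1 : 1 < p ^ suc e
    pe>1 = <-≤-trans (prime>1 pp) (m≤m*n p (p ^ e) {{m^n≢0 p e {{prime⇒nonZero pp}}}})
    y<x : y < x
    y<x = subst (y <_) (sym (trans x≡pe*y (*-comm (p ^ suc e) y))) (m<m*n y (p ^ suc e) {{>-nonZero y>0}} pe>1)
    y∣M : y ∣ M
    y∣M = go y (rec y<x) y>0 (λ q k qq qk∣y → pk∣M q k qq (∣-trans qk∣y y∣x))

product-map-interval-primes∣ : ∀ N (g : ℕ → ℕ) a j →
  (∀ x → a < x → x ≤ a + j → g x ≡ 1 ⊎ (g x ≡ x × Prime x × x ∣ N)) →
  product (map g (interval a j)) ∣ N
product-map-interval-primes∣ N g a zero    sel = 1∣ N
product-map-interval-primes∣ N g a (suc j) sel =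
  head∙rest (sel (suc a) ≤-refl (subst (suc a ≤_) (sym (+-suc a j)) (s≤s (m≤m+n a j))))
  where
  R = product (map g (interval (suc a) j))
  sel′ : ∀ x → suc a < x → x ≤ suc a + j → g x ≡ 1 ⊎ (g x ≡ x × Prime x × x ∣ N)
  sel′ x a<x x≤ = sel x (<⇒≤ a<x) (subst (x ≤_) (sym (+-suc a j)) x≤)
  R∣N : R ∣ N
  R∣N = product-map-interval-primes∣ N g (suc a) j sel′
  a+1∤R : Prime (suc a) → ¬ suc a ∣ R
  a+1∤R pp a+1∣R with prime∣product _ pp a+1∣R
  ... | y , y∈ , a+1∣y with ∈-map⁻ g y∈
  ... | x , x∈ , refl with ∈-interval⁻ x∈
  ... | a+1<x , x≤ with sel′ x a+1<x x≤
  ... | inj₁ gx≡1 = ¬prime[1] (subst Prime (∣1⇒≡1 (subst (suc a ∣_) gx≡1 a+1∣y)) pp)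
  ... | inj₂ (gx≡x , xp , _) with prime⇒irreducible xp (subst (suc a ∣_) gx≡x a+1∣y)
  ...   | inj₁ a+1≡1 = ¬prime[1] (subst Prime a+1≡1 pp)
  ...   | inj₂ a+1≡x = <-irrefl a+1≡x a+1<x
  head∙rest : g (suc a) ≡ 1 ⊎ (g (suc a) ≡ suc a × Prime (suc a) × suc a ∣ N) → g (suc a) * R ∣ N
  head∙rest (inj₁ g≡1) = subst (λ z → z * R ∣ N) (sym g≡1) (subst (_∣ N) (sym (+-identityʳ R)) R∣N)
  head∙rest (inj₂ (g≡x , pp , x∣N)) =
    subst (λ z → z * R ∣ N) (sym g≡x) (coprime-*-∣ (prime∤⇒coprime pp (a+1∤R pp)) x∣N R∣N)

-- Congruences

module _ {n : ℕ} .{{_ : NonZero n}} where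

  %-congʳ-* : ∀ x y z → x % n ≡ y % n → (x * z) % n ≡ (y * z) % n
  %-congʳ-* x y z x≡y = begin
    (x * z) % n             ≡⟨ %-distribˡ-* x z n ⟩
    (x % n * (z % n)) % n   ≡⟨ cong (λ r → (r * (z % n)) % n) x≡y ⟩
    (y % n * (z % n)) % n   ≡⟨ %-distribˡ-* y z n ⟨
    (y * z) % n             ∎
    where open ≡-Reasoning

  %-congʳ-+ : ∀ x y z → x % n ≡ y % n → (x + z) % n ≡ (y + z) % n
  %-congʳ-+ x y z x≡y = begin
    (x + z) % n             ≡⟨ %-distribˡ-+ x z n ⟩
    (x % n + z % n) % n     ≡⟨ cong (λ r → (r + z % n) % n) x≡y ⟩
    (y % n + z % n) % n     ≡⟨ %-distribˡ-+ y z n ⟨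
    (y + z) % n             ∎
    where open ≡-Reasoning

  %-cong-∣ : ∀ {m x y} .{{_ : NonZero m}} → m ∣ n → x % n ≡ y % n → x % m ≡ y % m
  %-cong-∣ {m} {x} {y} m∣n x≡y =
    trans (sym (m∣n⇒o%n%m≡o%m m n x m∣n)) (trans (cong (_% m) x≡y) (m∣n⇒o%n%m≡o%m m n y m∣n))

  %≡%⇒∣∸ : ∀ {x y} → y ≤ x → x % n ≡ y % n → n ∣ x ∸ y
  %≡%⇒∣∸ {x} {y} y≤x x≡y = divides (x / n ∸ y / n) (begin
    x ∸ y                                         ≡⟨ cong₂ _∸_ (m≡m%n+[m/n]*n x n) (m≡m%n+[m/n]*n y n) ⟩
    (x % n + x / n * n) ∸ (y % n + y / n * n)     ≡⟨ cong (λ r → (r + x / n * n) ∸ (y % n + y / n * n)) x≡y ⟩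
    (y % n + x / n * n) ∸ (y % n + y / n * n)     ≡⟨ [m+n]∸[m+o]≡n∸o (y % n) _ _ ⟩
    x / n * n ∸ y / n * n                         ≡⟨ *-distribʳ-∸ n (x / n) (y / n) ⟨
    (x / n ∸ y / n) * n                           ∎)
    where open ≡-Reasoning

  coprime-%-cong : ∀ {x y} → x % n ≡ y % n → Coprime y n → Coprime x n
  coprime-%-cong {x} {y} x≡y y⊥n (d∣x , d∣n) =
    y⊥n (∣n∣m%n⇒∣m d∣n (subst (_ ∣_) x≡y (%-presˡ-∣ d∣x d∣n)) , d∣n)

  %-injective-[1,n] : ∀ {x y} → 1 ≤ x → x ≤ n → 1 ≤ y → y ≤ n → x % n ≡ y % n → x ≡ y
  %-injective-[1,n] {x} {y} 1≤x x≤n 1≤y y≤n x≡y with m≤n⇒m<n∨m≡n x≤n | m≤n⇒m<n∨m≡n y≤n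
  ... | inj₁ x<n  | inj₁ y<n  = trans (sym (m<n⇒m%n≡m x<n)) (trans x≡y (m<n⇒m%n≡m y<n))
  ... | inj₂ x≡n  | inj₂ y≡n  = trans x≡n (sym y≡n)
  ... | inj₁ x<n  | inj₂ refl = ⊥-elim (<⇒≢ 1≤x (sym (trans (sym (m<n⇒m%n≡m x<n)) (trans x≡y (n%n≡0 n)))))
  ... | inj₂ refl | inj₁ y<n  = ⊥-elim (<⇒≢ 1≤y (sym (trans (sym (m<n⇒m%n≡m y<n)) (trans (sym x≡y) (n%n≡0 n)))))

coprime⇒∃inverse : ∀ {a n} .{{_ : NonZero n}} → Coprime a n → ∃[ w ] (w * a) % n ≡ 1 % n
coprime⇒∃inverse {a} {n@(suc Q)} a⊥n with coprime-Bézout a⊥n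
... | Bézout.+- x y 1+yn≡xa = x , trans (cong (_% n) (sym 1+yn≡xa)) ([m+kn]%n≡m%n 1 y n)
... | Bézout.-+ x y 1+xa≡yn = x * Q , (begin
  (x * Q * a) % n               ≡⟨ cong (_% n) (xy∙z≈xz∙y x Q a) ⟩
  (x * a * Q) % n               ≡⟨ %-remove-+ʳ (x * a * Q) n∣xa+1 ⟨
  (x * a * Q + (x * a + 1)) % n ≡⟨ cong (_% n) (regroup (x * a) Q) ⟩
  (1 + x * a * n) % n           ≡⟨ %-remove-+ʳ 1 (n∣m*n (x * a)) ⟩
  1 % n                         ∎)
  where
  open ≡-Reasoning
  n∣xa+1 : n ∣ x * a + 1
  n∣xa+1 = divides y (trans (+-comm (x * a) 1) 1+xa≡yn)
  regroup : ∀ A Q → A * Q + (A + 1) ≡ 1 + A * suc Q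
  regroup = solve-∀

k%a≡c%a⇒k≡c+a*t : ∀ {a k c} .{{_ : NonZero a}} → 1 ≤ k → 1 ≤ c → c ≤ a → k % a ≡ c % a → ∃[ t ] k ≡ c + a * t
k%a≡c%a⇒k≡c+a*t {a} {k} {c} 1≤k 1≤c c≤a k≡c with m≤n⇒m<n∨m≡n c≤a
... | inj₁ c<a = k / a , trans (m≡m%n+[m/n]*n k a) (cong₂ _+_ (trans k≡c (m<n⇒m%n≡m c<a)) (*-comm (k / a) a))
... | inj₂ refl with k / a in k/a≡ | trans (m≡m%n+[m/n]*n k a) (cong (_+ k / a * a) (trans k≡c (n%n≡0 a)))
...   | zero  | k≡0     = ⊥-elim (<⇒≢ 1≤k (sym k≡0))
...   | suc t | k≡a+t*a = t , trans k≡a+t*a (cong (a +_) (*-comm t a))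

angle-spec : ∀ a x .{{_ : NonZero a}} → 1 ≤ angle a x × angle a x ≤ a × angle a x % a ≡ x % a
angle-spec a@(suc _) x with x % a in x%a≡
... | zero  = z<s , ≤-refl , n%n≡0 a
... | suc r = z<s , subst (_≤ a) x%a≡ (<⇒≤ (m%n<n x a)) , subst (λ z → z % a ≡ z) x%a≡ (m%n%n≡m%n x a)

-- The search loop local to invMod is out of scope; unification names it.
private
  mutual
    inverseSearch : ℕ → ℕ → List ℕ → ℕ
    inverseSearch = _

    invMod≡inverseSearch : ∀ q r′ → invMod q r′ ≡ inverseSearch q r′ (applyUpTo suc q)
    invMod≡inverseSearch q r′ with applyUpTo suc q
    ... | _ = refl

∈-applyUpTo-suc : ∀ {x q} → 1 ≤ x → x ≤ q → x ∈ applyUpTo suc q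
∈-applyUpTo-suc {suc x} _ x<q = ∈-applyUpTo⁺ suc x<q

inverseSearch-sound : ∀ q r′ xs → (∃[ x ] x ∈ xs × T (modN q (x * r′) ≡ᵇ modN q 1)) →
  T (modN q (inverseSearch q r′ xs * r′) ≡ᵇ modN q 1)
inverseSearch-sound q r′ (y ∷ xs) (x , x∈ , x-inv) with modN q (y * r′) ≡ᵇ modN q 1 in y-inv
... | true = subst T (sym y-inv) tt
... | false with x∈
...   | here refl = ⊥-elim (subst T y-inv x-inv)
...   | there x∈xs = inverseSearch-sound q r′ xs (x , x∈xs , x-inv)

invMod-spec : ∀ {q} r′ .{{_ : NonZero q}} → Coprime r′ q → (invMod q r′ * r′) % q ≡ 1 % q
invMod-spec {q@(suc _)} r′ r′⊥q = ≡ᵇ⇒≡ _ _ (subst (λ v → T ((v * r′) % q ≡ᵇ 1 % q)) (sym (invMod≡inverseSearch q r′))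
  (inverseSearch-sound q r′ (applyUpTo suc q) (x , x∈ , ≡⇒≡ᵇ _ _ x-inv)))
  where
  w = proj₁ (coprime⇒∃inverse r′⊥q)
  x = angle q w
  x∈ : x ∈ applyUpTo suc q
  x∈ = ∈-applyUpTo-suc (proj₁ (angle-spec q w)) (proj₁ (proj₂ (angle-spec q w)))
  x-inv : (x * r′) % q ≡ 1 % q
  x-inv = trans (%-congʳ-* x w r′ (proj₂ (proj₂ (angle-spec q w)))) (proj₂ (coprime⇒∃inverse r′⊥q))

-- Binomial coefficients and the primorial

m≤n⇒m∣n! : ∀ {m n} → 0 < m → m ≤ n → m ∣ n !
m≤n⇒m∣n! {suc m} _ m+1≤n = ∣-trans (m∣m*n (m !)) (m≤n⇒m!∣n! m+1≤n)

prime∣!⇒≤ : ∀ {p} m → Prime p → p ∣ m ! → p ≤ m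
prime∣!⇒≤ zero    pp p∣1 = ⊥-elim (¬prime[1] (subst Prime (∣1⇒≡1 p∣1) pp))
prime∣!⇒≤ (suc m) pp p∣m+1! with euclidsLemma (suc m) (m !) pp p∣m+1!
... | inj₁ p∣m+1 = ∣⇒≤ p∣m+1
... | inj₂ p∣m!  = m≤n⇒m≤1+n (prime∣!⇒≤ m pp p∣m!)

nCk≤2^n : ∀ n k → n C k ≤ 2 ^ n
nCk≤2^n zero    zero    = ≤-refl
nCk≤2^n zero    (suc k) = z≤n
nCk≤2^n (suc n) zero    = m^n>0 2 (suc n)
nCk≤2^n (suc n) (suc k) = begin
  suc n C suc k         ≡⟨ nCk+nC[k+1]≡[n+1]C[k+1] n k ⟨
  n C k + n C suc k     ≤⟨ +-mono-≤ (nCk≤2^n n k) (nCk≤2^n n (suc k)) ⟩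
  2 ^ n + 2 ^ n         ≡⟨ cong (2 ^ n +_) (+-identityʳ (2 ^ n)) ⟨
  2 ^ suc n             ∎
  where open ≤-Reasoning

nCk*k!*[n∸k]!≡n! : ∀ {n k} → k ≤ n → (n C k) * (k ! * (n ∸ k) !) ≡ n !
nCk*k!*[n∸k]!≡n! {n} {k} k≤n =
  trans (cong (_* (k ! * (n ∸ k) !)) (nCk≡n!/k![n-k]! k≤n)) (m/n*n≡m {{k !* (n ∸ k) !≢0}} (k![n∸k]!∣n! k≤n))

nCk>0 : ∀ {n k} → k ≤ n → 0 < n C k
nCk>0 {n} {k} k≤n = n≢0⇒n>0 λ C≡0 →
  <⇒≢ (1≤n! n) (sym (trans (sym (nCk*k!*[n∸k]!≡n! k≤n)) (cong (_* (k ! * (n ∸ k) !)) C≡0)))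

prime∣[2k+1]Ck : ∀ k {p} → Prime p → suc k < p → p ≤ k + suc k → p ∣ (k + suc k) C k
prime∣[2k+1]Ck k {p} pp k+1<p p≤2k+1 with euclidsLemma ((k + suc k) C k) (k ! * (suc k) !) pp p∣C*k!*[k+1]!
  where
  p∣C*k!*[k+1]! : p ∣ ((k + suc k) C k) * (k ! * (suc k) !)
  p∣C*k!*[k+1]! = subst (λ j → p ∣ ((k + suc k) C k) * (k ! * j !)) (m+n∸m≡n k (suc k))
    (subst (p ∣_) (sym (nCk*k!*[n∸k]!≡n! (m≤m+n k (suc k)))) (m≤n⇒m∣n! (<-trans z<s k+1<p) p≤2k+1))
... | inj₁ p∣C = p∣C
... | inj₂ p∣k!*[k+1]! with euclidsLemma (k !) ((suc k) !) pp p∣k!*[k+1]!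
...   | inj₁ p∣k!     = ⊥-elim (<⇒≱ k+1<p (m≤n⇒m≤1+n (prime∣!⇒≤ k pp p∣k!)))
...   | inj₂ p∣[k+1]! = ⊥-elim (<⇒≱ k+1<p (prime∣!⇒≤ (suc k) pp p∣[k+1]!))

primeOr1 : ℕ → ℕ
primeOr1 x = if does (prime? x) then x else 1

primorial : ℕ → ℕ
primorial Y = product (map primeOr1 (interval 0 Y))

primeOr1-¬prime : ∀ {x} → ¬ Prime x → primeOr1 x ≡ 1
primeOr1-¬prime {x} ¬px with prime? x
... | yes px = ⊥-elim (¬px px)
... | no _   = refl

primeOr1-selects : ∀ {N} x → (Prime x → x ∣ N) → primeOr1 x ≡ 1 ⊎ (primeOr1 x ≡ x × Prime x × x ∣ N)
primeOr1-selects x x∣N with prime? x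
... | yes px = inj₂ (refl , px , x∣N px)
... | no _   = inj₁ refl

primeOr1>0 : ∀ x → 0 < primeOr1 x
primeOr1>0 x with prime? x
... | yes px = <-trans z<s (prime>1 px)
... | no _   = z<s

primorial-+ : ∀ j k → primorial (j + k) ≡ primorial j * product (map primeOr1 (interval j k))
primorial-+ = product-map-interval-+ primeOr1 0

primorial-suc : ∀ Y → primorial (suc Y) ≡ primorial Y * primeOr1 (suc Y)
primorial-suc Y = begin
  primorial (suc Y)                  ≡⟨ cong primorial (+-comm 1 Y) ⟩
  primorial (Y + 1)                  ≡⟨ primorial-+ Y 1 ⟩
  primorial Y * (primeOr1 (suc Y) * 1) ≡⟨ cong (primorial Y *_) (*-identityʳ _) ⟩
  primorial Y * primeOr1 (suc Y)     ∎
  where open ≡-Reasoning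

primeOr1[2k+2]≤16 : ∀ k → primeOr1 (suc (suc (k + k))) ≤ 16
primeOr1[2k+2]≤16 zero    = s≤s (s≤s z≤n)
primeOr1[2k+2]≤16 (suc k) = subst (_≤ 16) (sym (primeOr1-¬prime ¬prime)) (s≤s z≤n)
  where
  2∣2k+4 : 2 ∣ suc (suc (suc k + suc k))
  2∣2k+4 = divides (suc (suc k)) (double k)
    where
    double : ∀ k → suc (suc (suc k + suc k)) ≡ suc (suc k) * 2
    double = solve-∀
  ¬prime : ¬ Prime (suc (suc (suc k + suc k)))
  ¬prime pp with prime⇒irreducible pp 2∣2k+4
  ... | inj₁ ()
  ... | inj₂ ()

even-or-odd : ∀ Y → ∃[ k ] (Y ≡ k + k ⊎ Y ≡ suc (k + k))
even-or-odd zero = 0 , inj₁ refl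
even-or-odd (suc Y) with even-or-odd Y
... | k , inj₁ Y≡2k   = k , inj₂ (cong suc Y≡2k)
... | k , inj₂ Y≡2k+1 = suc k , inj₁ (cong suc (trans Y≡2k+1 (sym (+-suc k k))))

primorial-step : ∀ Y → primeOr1 (suc Y) ≤ 16 → primorial Y ≤ 2 ^ (4 * Y) → primorial (suc Y) ≤ 2 ^ (4 * suc Y)
primorial-step Y p≤16 ih = begin
  primorial (suc Y)            ≡⟨ primorial-suc Y ⟩
  primorial Y * primeOr1 (suc Y) ≤⟨ *-mono-≤ ih p≤16 ⟩
  2 ^ (4 * Y) * 2 ^ 4          ≡⟨ ^-distribˡ-+-* 2 (4 * Y) 4 ⟨
  2 ^ (4 * Y + 4)              ≡⟨ cong (2 ^_) (+-comm (4 * Y) 4 ) ⟩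
  2 ^ (4 + 4 * Y)              ≡⟨ cong (2 ^_) (*-suc 4 Y) ⟨
  2 ^ (4 * suc Y)              ∎
  where open ≤-Reasoning

-- The primes in (k + 2, 2k + 3] all divide the binomial coefficient (2k + 3 choose k + 1) ≤ 2 ^ (2k + 3).
primorial[2k+3]≤ : ∀ k → primorial (suc (suc k) + suc k) ≤ primorial (suc (suc k)) * 2 ^ (suc k + suc (suc k))
primorial[2k+3]≤ k = begin
  primorial (suc (suc k) + suc k) ≡⟨ primorial-+ (suc (suc k)) (suc k) ⟩
  primorial (suc (suc k)) * middle ≤⟨ *-monoʳ-≤ (primorial (suc (suc k))) (∣⇒≤ {{>-nonZero binom>0}} middle∣binom) ⟩
  primorial (suc (suc k)) * binom  ≤⟨ *-monoʳ-≤ (primorial (suc (suc k))) (nCk≤2^n (suc k + suc (suc k)) (suc k)) ⟩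
  primorial (suc (suc k)) * 2 ^ (suc k + suc (suc k)) ∎
  where
  open ≤-Reasoning
  middle = product (map primeOr1 (interval (suc (suc k)) (suc k)))
  binom = (suc k + suc (suc k)) C (suc k)
  binom>0 : 0 < binom
  binom>0 = nCk>0 (m≤m+n (suc k) (suc (suc k)))
  middle∣binom : middle ∣ binom
  middle∣binom = product-map-interval-primes∣ binom primeOr1 (suc (suc k)) (suc k) λ x k+2<x x≤ →
    primeOr1-selects x (λ px → prime∣[2k+1]Ck (suc k) px k+2<x (subst (x ≤_) (+-comm (suc (suc k)) (suc k)) x≤))

primorial≤16^ : ∀ Y → primorial Y ≤ 2 ^ (4 * Y)
primorial≤16^ Y = go Y (<-wellFounded Y)
  where
  go : ∀ Y → Acc _<_ Y → primorial Y ≤ 2 ^ (4 * Y)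
  go Y (acc rec) with even-or-odd Y
  ... | zero  , inj₁ refl = ≤-refl
  ... | suc k , inj₁ refl rewrite +-suc k k =
    primorial-step (suc (k + k)) (primeOr1[2k+2]≤16 k) (go (suc (k + k)) (rec ≤-refl))
  ... | zero  , inj₂ refl = primorial-step 0 (s≤s z≤n) ≤-refl
  ... | suc k , inj₂ refl = begin
    primorial (suc (suc k + suc k))                     ≤⟨ primorial[2k+3]≤ k ⟩
    primorial (suc (suc k)) * 2 ^ (suc k + suc (suc k)) ≤⟨ *-monoˡ-≤ _ (go (suc (suc k)) (rec k+2<2k+3)) ⟩
    2 ^ (4 * suc (suc k)) * 2 ^ (suc k + suc (suc k))   ≡⟨ ^-distribˡ-+-* 2 (4 * suc (suc k)) _ ⟨
    2 ^ (4 * suc (suc k) + (suc k + suc (suc k)))       ≤⟨ ^-monoʳ-≤ 2 exponent≤ ⟩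
    2 ^ (4 * suc (suc k + suc k))                       ∎
    where
    open ≤-Reasoning
    k+2<2k+3 : suc (suc k) < suc (suc k + suc k)
    k+2<2k+3 = s≤s (s≤s (subst (suc k ≤_) (sym (+-suc k k)) (s≤s (m≤m+n k k))))
    exponents : ∀ k → 4 * suc (suc k) + (suc k + suc (suc k)) + suc (k + k) ≡ 4 * suc (suc k + suc k)
    exponents = solve-∀
    exponent≤ : 4 * suc (suc k) + (suc k + suc (suc k)) ≤ 4 * suc (suc k + suc k)
    exponent≤ = subst (4 * suc (suc k) + (suc k + suc (suc k)) ≤_) (exponents k) (m≤m+n _ (suc (k + k)))

-- Integer logarithms and square roots

ilog-exists : ∀ b Z → ∃[ e ] (1 < b → 0 < Z → b ^ e ≤ Z × Z < b ^ suc e)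
ilog-exists b zero                = 0 , λ _ ()
ilog-exists b (suc zero)          = 0 , λ 1<b _ → ≤-refl , subst (1 <_) (sym (*-identityʳ b)) 1<b
ilog-exists b (suc Z@(suc _)) with ilog-exists b Z
... | e , spec with b ^ suc e ≤? suc Z
...   | yes b^[e+1]≤ = suc e , λ 1<b _ → b^[e+1]≤ , <-≤-trans (s≤s (proj₂ (spec 1<b z<s))) (b^[e+1]≤b^[e+2] 1<b)
  where
  b^[e+1]≤b^[e+2] : 1 < b → suc (b ^ suc e) ≤ b ^ suc (suc e)
  b^[e+1]≤b^[e+2] 1<b = subst (b ^ suc e <_) (*-comm (b ^ suc e) b)
    (m<m*n (b ^ suc e) b {{m^n≢0 b (suc e) {{>-nonZero (<-trans z<s 1<b)}}}} 1<b)
...   | no  b^[e+1]≰ = e , λ 1<b _ → m≤n⇒m≤1+n (proj₁ (spec 1<b z<s)) , ≰⇒> b^[e+1]≰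

ilog : ℕ → ℕ → ℕ
ilog b Z = proj₁ (ilog-exists b Z)

b^ilog≤ : ∀ {b Z} → 1 < b → 0 < Z → b ^ ilog b Z ≤ Z
b^ilog≤ {b} {Z} 1<b Z>0 = proj₁ (proj₂ (ilog-exists b Z) 1<b Z>0)

ilog-greatest : ∀ {b Z k} → 1 < b → 0 < Z → b ^ k ≤ Z → k ≤ ilog b Z
ilog-greatest {b} {Z} {k} 1<b Z>0 b^k≤Z with k ≤? ilog b Z
... | yes k≤ = k≤
... | no  k≰ = ⊥-elim (<⇒≱ (proj₂ (proj₂ (ilog-exists b Z) 1<b Z>0))
                           (≤-trans (^-monoʳ-≤ b {{>-nonZero (<-trans z<s 1<b)}} (≰⇒> k≰)) b^k≤Z))

sqrt-exists : ∀ n → ∃[ s ] s * s ≤ n × n < suc s * suc s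
sqrt-exists zero = 0 , z≤n , z<s
sqrt-exists (suc n) with sqrt-exists n
... | s , s²≤n , n<[s+1]² with suc s * suc s ≤? suc n
...   | yes [s+1]²≤ = suc s , [s+1]²≤ , ≤-<-trans n<[s+1]² (*-mono-< (n<1+n (suc s)) (n<1+n (suc s)))
...   | no  [s+1]²≰ = s , m≤n⇒m≤1+n s²≤n , ≰⇒> [s+1]²≰

length-filter-interval≥ : ∀ {P : ℕ → Set} (P? : ∀ x → Dec (P x)) a j t → t ≤ j →
  (∀ x → a < x → x ≤ a + t → P x) → t ≤ length (filter P? (interval a j))
length-filter-interval≥ P? a j       zero    _       _   = z≤n
length-filter-interval≥ P? a (suc j) (suc t) (s≤s t≤j) all with P? (suc a)
... | yes _  = s≤s (length-filter-interval≥ P? (suc a) j t t≤j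
                     (λ x a<x x≤ → all x (<⇒≤ a<x) (subst (x ≤_) (sym (+-suc a t)) x≤)))
... | no ¬Pa = ⊥-elim (¬Pa (all (suc a) ≤-refl (subst (suc a ≤_) (sym (+-suc a t)) (s≤s (m≤m+n a t)))))

isqrt≥ : ∀ {n t} → t * t ≤ n → t ≤ isqrt n
isqrt≥ {n} {zero}  _    = z≤n
isqrt≥ {n} {suc t} t²≤n = subst (λ xs → suc t ≤ length (filter (λ s → s * s ≤? n) xs)) (sym (applyUpTo≡interval 0 n))
  (length-filter-interval≥ (λ s → s * s ≤? n) 0 n (suc t) (≤-trans (m≤m*n (suc t) (suc t)) t²≤n)
    (λ x _ x≤t+1 → ≤-trans (*-mono-≤ x≤t+1 x≤t+1) t²≤n))

-- The smooth part ∏_{p ≤ Y} p ^ ⌊log_p Z⌋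

primePowerUpTo : ℕ → ℕ → ℕ
primePowerUpTo Z x = if does (prime? x) then x ^ ilog x Z else 1

smoothPart : ℕ → ℕ → ℕ
smoothPart Y Z = product (map (primePowerUpTo Z) (interval 0 Y))

primePowerUpTo-prime : ∀ {x} Z → Prime x → primePowerUpTo Z x ≡ x ^ ilog x Z
primePowerUpTo-prime {x} Z px with prime? x
... | yes _  = refl
... | no ¬px = ⊥-elim (¬px px)

primePowerUpTo≤ : ∀ {Z} x → 0 < Z → primePowerUpTo Z x ≤ Z
primePowerUpTo≤ x Z>0 with prime? x
... | yes px = b^ilog≤ (prime>1 px) Z>0
... | no _   = Z>0

primePowerUpTo>0 : ∀ Z x → 0 < primePowerUpTo Z x
primePowerUpTo>0 Z x with prime? x
... | yes px = m^n>0 x {{prime⇒nonZero px}} (ilog x Z)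
... | no _   = z<s

primePowerUpTo≤-large : ∀ {Z c t} x → 0 < Z → 1 ≤ c → t < x → Z ≤ c * suc t ^ 8 →
  primePowerUpTo Z x ≤ c * primeOr1 x ^ 8
primePowerUpTo≤-large {Z} {c} {t} x Z>0 1≤c t<x Z≤ with prime? x
... | yes px = begin
  x ^ ilog x Z  ≤⟨ b^ilog≤ (prime>1 px) Z>0 ⟩
  Z             ≤⟨ Z≤ ⟩
  c * suc t ^ 8 ≤⟨ *-monoʳ-≤ c (^-monoˡ-≤ 8 t<x) ⟩
  c * x ^ 8     ∎
  where open ≤-Reasoning
... | no _ = subst (1 ≤_) (sym (*-identityʳ c)) 1≤c

n<2^n : ∀ n → n < 2 ^ n
n<2^n zero    = z<s
n<2^n (suc n) = begin-strict
  suc n         ≤⟨ n<2^n n ⟩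
  2 ^ n         <⟨ m<m+n (2 ^ n) (m^n>0 2 n) ⟩
  2 ^ n + 2 ^ n ≡⟨ cong (2 ^ n +_) (+-identityʳ (2 ^ n)) ⟨
  2 ^ suc n     ∎
  where open ≤-Reasoning

t²≤Y⇒t≤Y : ∀ t {Y} → t * t ≤ Y → t ≤ Y
t²≤Y⇒t≤Y zero    _    = z≤n
t²≤Y⇒t≤Y (suc t) t²≤Y = ≤-trans (m≤m*n (suc t) (suc t)) t²≤Y

smoothPart-head≤ : ∀ {Y Z c t} → 1 ≤ c → t * t ≤ Y → 0 < Z → Z ≤ c * suc t ^ 8 →
  product (map (primePowerUpTo Z) (interval 0 t)) ≤ c ^ Y * 2 ^ (8 * Y)
smoothPart-head≤ {Y} {Z} {c} {t} 1≤c t²≤Y Z>0 Z≤ = begin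
  product (map (primePowerUpTo Z) (interval 0 t))
    ≤⟨ product-map-≤-^ (primePowerUpTo Z) Z (interval 0 t) (λ {x} _ → primePowerUpTo≤ x Z>0) ⟩
  Z ^ length (interval 0 t)  ≡⟨ cong (Z ^_) (length-interval 0 t) ⟩
  Z ^ t                      ≤⟨ ^-monoˡ-≤ t Z≤ ⟩
  (c * suc t ^ 8) ^ t        ≡⟨ ^-distrib-* c (suc t ^ 8) t ⟩
  c ^ t * (suc t ^ 8) ^ t    ≤⟨ *-mono-≤ (^-monoʳ-≤ c {{>-nonZero 1≤c}} (t²≤Y⇒t≤Y t t²≤Y))
                                         (^-monoˡ-≤ t (^-monoˡ-≤ 8 {suc t} {2 ^ t} (n<2^n t))) ⟩
  c ^ Y * ((2 ^ t) ^ 8) ^ t  ≡⟨ cong (λ x → c ^ Y * x ^ t) (^-*-assoc 2 t 8) ⟩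
  c ^ Y * (2 ^ (t * 8)) ^ t  ≡⟨ cong (c ^ Y *_) (^-*-assoc 2 (t * 8) t) ⟩
  c ^ Y * 2 ^ (t * 8 * t)    ≤⟨ *-monoʳ-≤ (c ^ Y) (^-monoʳ-≤ 2 (subst (_≤ 8 * Y) (sym (t*8*t≡8*t² t)) (*-monoʳ-≤ 8 t²≤Y))) ⟩
  c ^ Y * 2 ^ (8 * Y)        ∎
  where
  open ≤-Reasoning
  t*8*t≡8*t² : ∀ t → t * 8 * t ≡ 8 * (t * t)
  t*8*t≡8*t² = solve-∀

smoothPart-tail≤ : ∀ {Y Z c t} → 1 ≤ c → t ≤ Y → 0 < Z → Z ≤ c * suc t ^ 8 →
  product (map (primePowerUpTo Z) (interval t (Y ∸ t))) ≤ c ^ Y * 2 ^ (32 * Y)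
smoothPart-tail≤ {Y} {Z} {c} {t} 1≤c t≤Y Z>0 Z≤ = begin
  product (map (primePowerUpTo Z) (interval t (Y ∸ t)))
    ≤⟨ product-map-mono-≤ (interval t (Y ∸ t)) (λ {x} x∈ → primePowerUpTo≤-large x Z>0 1≤c (proj₁ (∈-interval⁻ x∈)) Z≤) ⟩
  product (map (λ x → c * primeOr1 x ^ 8) (interval t (Y ∸ t)))
    ≡⟨ product-map-* (λ _ → c) (λ x → primeOr1 x ^ 8) (interval t (Y ∸ t)) ⟩
  product (map (λ _ → c) (interval t (Y ∸ t))) * product (map (λ x → primeOr1 x ^ 8) (interval t (Y ∸ t)))
    ≤⟨ *-mono-≤ (product-map-≤-^ (λ _ → c) c (interval t (Y ∸ t)) (λ _ → ≤-refl))
                (≤-reflexive (product-map-^ primeOr1 8 (interval t (Y ∸ t)))) ⟩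
  c ^ length (interval t (Y ∸ t)) * primes ^ 8
    ≤⟨ *-mono-≤ (^-monoʳ-≤ c {{>-nonZero 1≤c}} (≤-trans (≤-reflexive (length-interval t (Y ∸ t))) (m∸n≤m Y t)))
                (^-monoˡ-≤ 8 primes≤primorial) ⟩
  c ^ Y * primorial Y ^ 8    ≤⟨ *-monoʳ-≤ (c ^ Y) (^-monoˡ-≤ 8 (primorial≤16^ Y)) ⟩
  c ^ Y * (2 ^ (4 * Y)) ^ 8  ≡⟨ cong (c ^ Y *_) (^-*-assoc 2 (4 * Y) 8) ⟩
  c ^ Y * 2 ^ (4 * Y * 8)    ≡⟨ cong (λ e → c ^ Y * 2 ^ e) (4*Y*8≡32*Y Y) ⟩
  c ^ Y * 2 ^ (32 * Y)       ∎
  where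
  open ≤-Reasoning
  primes = product (map primeOr1 (interval t (Y ∸ t)))
  primes≤primorial : primes ≤ primorial Y
  primes≤primorial = subst (primes ≤_) (trans (sym (primorial-+ t (Y ∸ t))) (cong primorial (m+[n∸m]≡n t≤Y)))
    (m≤n*m primes (primorial t) {{>-nonZero (product-map-pos primeOr1 (interval 0 t) (λ {x} _ → primeOr1>0 x))}})
  4*Y*8≡32*Y : ∀ Y → 4 * Y * 8 ≡ 32 * Y
  4*Y*8≡32*Y = solve-∀

-- Primes p ≤ √Y contribute at most Z each; for larger p, p ^ ⌊log_p Z⌋ ≤ Z ≤ c p⁸ and the primorial bound applies.
smoothPart≤ : ∀ {Y Z c t} → 1 ≤ c → t * t ≤ Y → 0 < Z → Z ≤ c * suc t ^ 8 → smoothPart Y Z ≤ (c * c * 2 ^ 40) ^ Y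
smoothPart≤ {Y} {Z} {c} {t} 1≤c t²≤Y Z>0 Z≤ = begin
  smoothPart Y Z                                  ≡⟨ cong (λ k → smoothPart k Z) (m+[n∸m]≡n (t²≤Y⇒t≤Y t t²≤Y)) ⟨
  smoothPart (t + (Y ∸ t)) Z                      ≡⟨ product-map-interval-+ (primePowerUpTo Z) 0 t (Y ∸ t) ⟩
  product (map (primePowerUpTo Z) (interval 0 t)) * product (map (primePowerUpTo Z) (interval t (Y ∸ t)))
    ≤⟨ *-mono-≤ (smoothPart-head≤ {Y} {Z} {c} {t} 1≤c t²≤Y Z>0 Z≤)
                (smoothPart-tail≤ {Y} {Z} {c} {t} 1≤c (t²≤Y⇒t≤Y t t²≤Y) Z>0 Z≤) ⟩
  (c ^ Y * 2 ^ (8 * Y)) * (c ^ Y * 2 ^ (32 * Y))  ≡⟨ interchange (c ^ Y) (2 ^ (8 * Y)) (c ^ Y) (2 ^ (32 * Y)) ⟩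
  (c ^ Y * c ^ Y) * (2 ^ (8 * Y) * 2 ^ (32 * Y))  ≡⟨ cong₂ _*_ (^-distrib-* c c Y) (^-distribˡ-+-* 2 (8 * Y) (32 * Y)) ⟨
  (c * c) ^ Y * 2 ^ (8 * Y + 32 * Y)              ≡⟨ cong (λ e → (c * c) ^ Y * 2 ^ e) (*-distribʳ-+ Y 8 32) ⟨
  (c * c) ^ Y * 2 ^ (40 * Y)                      ≡⟨ cong ((c * c) ^ Y *_) (^-*-assoc 2 40 Y) ⟨
  (c * c) ^ Y * (2 ^ 40) ^ Y                      ≡⟨ ^-distrib-* (c * c) (2 ^ 40) Y ⟨
  (c * c * 2 ^ 40) ^ Y                            ∎
  where open ≤-Reasoning

-- Roots of a linear form a i + b modulo a prime

∃-≡-in-window : ∀ {p} ρ lo .{{_ : NonZero p}} → ρ < p → ∃[ h ] lo < ρ + h * p × ρ + h * p ≤ lo + p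
∃-≡-in-window {p} ρ lo ρ<p = h , lo<i , i≤
  where
  M = lo + p ∸ ρ
  h = M / p
  ρ+M≡ : ρ + M ≡ lo + p
  ρ+M≡ = m+[n∸m]≡n (≤-trans (<⇒≤ ρ<p) (m≤n+m p lo))
  i≤ : ρ + h * p ≤ lo + p
  i≤ = subst (ρ + h * p ≤_) ρ+M≡ (+-monoʳ-≤ ρ (m/n*n≤m M p))
  lo<i : lo < ρ + h * p
  lo<i = +-cancelʳ-< p lo (ρ + h * p) (begin-strict
    lo + p                 ≡⟨ ρ+M≡ ⟨
    ρ + M                  ≡⟨ cong (ρ +_) (m≡m%n+[m/n]*n M p) ⟩
    ρ + (M % p + h * p)    <⟨ +-monoʳ-< ρ (+-monoˡ-< (h * p) (m%n<n M p)) ⟩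
    ρ + (p + h * p)        ≡⟨ x+[p+y]≡[x+y]+p ρ p (h * p) ⟩
    ρ + h * p + p          ∎)
    where
    open ≤-Reasoning
    x+[p+y]≡[x+y]+p : ∀ x p y → x + (p + y) ≡ x + y + p
    x+[p+y]≡[x+y]+p = solve-∀

%-cong-affine : ∀ {n x y} .{{_ : NonZero n}} a b → x % n ≡ y % n → (a * x + b) % n ≡ (a * y + b) % n
%-cong-affine {n} {x} {y} a b x≡y = %-congʳ-+ (a * x) (a * y) b
  (trans (cong (_% n) (*-comm a x)) (trans (%-congʳ-* x y a x≡y) (cong (_% n) (*-comm y a))))

∃-root-in-window : ∀ {p a} b lo span .{{_ : NonZero p}} → Coprime a p → p ≤ span →
  ∃[ i ] lo < i × i ≤ lo + span × p ∣ a * i + b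
∃-root-in-window {p@(suc P)} {a} b lo span a⊥p p≤span with coprime⇒∃inverse a⊥p
... | w , wa≡1 = i , lo<i , ≤-trans i≤ (+-monoʳ-≤ lo p≤span) , m%n≡0⇒n∣m (a * i + b) p ai+b≡0
  where
  -- -b w is a root; P b w is the same residue class written without subtraction.
  i₀ = P * b * w
  ai₀+b≡0 : (a * i₀ + b) % p ≡ 0
  ai₀+b≡0 = begin
    (a * i₀ + b) % p             ≡⟨ cong (_% p) (regroup a P b w) ⟩
    ((w * a) * (P * b) + b) % p  ≡⟨ %-congʳ-+ (w * a * (P * b)) (1 * (P * b)) b (%-congʳ-* (w * a) 1 (P * b) wa≡1) ⟩
    (1 * (P * b) + b) % p        ≡⟨ cong (_% p) (1*Pb+b≡b*p P b) ⟩
    (b * p) % p                  ≡⟨ m*n%n≡0 b p ⟩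
    0                            ∎
    where
    open ≡-Reasoning
    regroup : ∀ a P b w → a * (P * b * w) + b ≡ (w * a) * (P * b) + b
    regroup = solve-∀
    1*Pb+b≡b*p : ∀ P b → 1 * (P * b) + b ≡ b * suc P
    1*Pb+b≡b*p = solve-∀
  window = ∃-≡-in-window (i₀ % p) lo (m%n<n i₀ p)
  h = proj₁ window
  i = i₀ % p + h * p
  lo<i = proj₁ (proj₂ window)
  i≤ = proj₂ (proj₂ window)
  i≡i₀ : i % p ≡ i₀ % p
  i≡i₀ = trans ([m+kn]%n≡m%n (i₀ % p) h p) (m%n%n≡m%n i₀ p)
  ai+b≡0 : (a * i + b) % p ≡ 0
  ai+b≡0 = trans (%-cong-affine a b i≡i₀) ai₀+b≡0

-- With p r ≡ 1 and c ≡ b r (mod a), every multiple p (c + a t) is ≡ b (mod a), i.e. of the form a i + b.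
piece⇒root : ∀ {a} b r p t lo hi B .{{_ : NonZero a}} → (p * r) % a ≡ 1 % a → b < p → b ≤ B →
  a * lo < p * (angle a (b * r) + a * t) → p * (angle a (b * r) + a * t) ≤ a * hi →
  ∃[ i ] lo ∸ B < i × i ≤ hi × p ∣ a * i + b
piece⇒root {a} b r p t lo hi B pr≡1 b<p b≤B lo< ≤hi = i , lo∸B<i , i≤hi , divides (c + a * t) (trans ai+b≡y (*-comm p _))
  where
  c = angle a (b * r)
  y = p * (c + a * t)
  y≡b : y % a ≡ b % a
  y≡b = begin
    y % a                 ≡⟨ cong (_% a) (expand p c a t) ⟩
    (c * p + p * t * a) % a ≡⟨ [m+kn]%n≡m%n (c * p) (p * t) a ⟩
    (c * p) % a           ≡⟨ %-congʳ-* c (b * r) p (proj₂ (proj₂ (angle-spec a (b * r)))) ⟩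
    (b * r * p) % a       ≡⟨ cong (_% a) (swap b r p) ⟩
    (p * r * b) % a       ≡⟨ %-congʳ-* (p * r) 1 b pr≡1 ⟩
    (1 * b) % a           ≡⟨ cong (_% a) (*-identityˡ b) ⟩
    b % a                 ∎
    where
    open ≡-Reasoning
    expand : ∀ p c a t → p * (c + a * t) ≡ c * p + p * t * a
    expand = solve-∀
    swap : ∀ b r p → b * r * p ≡ p * r * b
    swap = solve-∀
  b<y : b < y
  b<y = <-≤-trans b<p (m≤m*n p (c + a * t) {{>-nonZero (≤-trans (proj₁ (angle-spec a (b * r))) (m≤m+n c (a * t)))}})
  i = (y ∸ b) / a
  ai+b≡y : a * i + b ≡ y
  ai+b≡y = trans (cong (_+ b) (m*[n/m]≡n (%≡%⇒∣∸ (<⇒≤ b<y) y≡b))) (m∸n+n≡m (<⇒≤ b<y))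
  i≤hi : i ≤ hi
  i≤hi = *-cancelˡ-≤ a (≤-trans (≤-trans (m≤m+n (a * i) b) (≤-reflexive ai+b≡y)) ≤hi)
  i>0 : 0 < i
  i>0 = n≢0⇒n>0 λ i≡0 →
    <⇒≢ b<y (trans (sym (trans (cong (λ j → a * j + b) i≡0) (cong (_+ b) (*-zeroʳ a)))) ai+b≡y)
  lo∸B<i : lo ∸ B < i
  lo∸B<i = m<n+o⇒m∸n<o lo B {{>-nonZero i>0}} (*-cancelˡ-< a lo (B + i) (begin-strict
    a * lo        <⟨ lo< ⟩
    y             ≡⟨ ai+b≡y ⟨
    a * i + b     ≤⟨ +-monoʳ-≤ (a * i) (≤-trans b≤B (m≤n*m B a)) ⟩
    a * i + a * B ≡⟨ *-distribˡ-+ a i B ⟨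
    a * (i + B)   ≡⟨ cong (a *_) (+-comm i B) ⟩
    a * (B + i)   ∎))
    where open ≤-Reasoning

cofactor≡angle+a*t : ∀ {a} b r p i k .{{_ : NonZero a}} → (p * r) % a ≡ 1 % a → 0 < b →
  a * i + b ≡ p * k → ∃[ t ] k ≡ angle a (b * r) + a * t
cofactor≡angle+a*t {a} b r p i k pr≡1 b>0 ai+b≡pk =
  k%a≡c%a⇒k≡c+a*t k>0 (proj₁ (angle-spec a (b * r))) (proj₁ (proj₂ (angle-spec a (b * r)))) k≡c
  where
  k>0 : 0 < k
  k>0 = n≢0⇒n>0 λ { refl → <⇒≢ (<-≤-trans b>0 (m≤n+m b (a * i))) (sym (trans ai+b≡pk (*-zeroʳ p))) }
  k≡c : k % a ≡ angle a (b * r) % a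
  k≡c = begin
    k % a                   ≡⟨ cong (_% a) (*-identityʳ k) ⟨
    (k * 1) % a             ≡⟨ cong (_% a) (*-comm k 1) ⟩
    (1 * k) % a             ≡⟨ %-congʳ-* (p * r) 1 k pr≡1 ⟨
    (p * r * k) % a         ≡⟨ cong (_% a) (swap p r k) ⟩
    (p * k * r) % a         ≡⟨ cong (λ x → (x * r) % a) ai+b≡pk ⟨
    ((a * i + b) * r) % a   ≡⟨ cong (_% a) (expand a i b r) ⟩
    (b * r + i * r * a) % a ≡⟨ [m+kn]%n≡m%n (b * r) (i * r) a ⟩
    (b * r) % a             ≡⟨ proj₂ (proj₂ (angle-spec a (b * r))) ⟨
    angle a (b * r) % a     ∎
    where
    open ≡-Reasoning
    swap : ∀ p r k → p * r * k ≡ p * k * r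
    swap = solve-∀
    expand : ∀ a i b r → (a * i + b) * r ≡ b * r + i * r * a
    expand = solve-∀

divN-greatest : ∀ {K x t} → 0 < K → t * K ≤ x → t ≤ divN K x
divN-greatest {suc K} {x} {t} _ tK≤x = ≤-trans (≤-reflexive (sym (m*n/n≡m t (suc K)))) (/-monoˡ-≤ (suc K) tK≤x)

-- (l − m) n < p and p (c + a t) ≤ a l n force (l − m)(c + a t) < a l, which is t ≤ H.
index≤H : ∀ {l m a n p} b r t .{{_ : NonZero a}} → m < l → (l ∸ m) * n < p →
  p * (angle a (b * r) + a * t) ≤ a * l * n → t ≤ H l m a b r
index≤H {l} {m} {a} {n} {p} b r t m<l dn<p p*D≤aln =
  divN-greatest (*-mono-< (>-nonZero⁻¹ a) d>0)
    (≤-trans (≤-reflexive (rearrange t a d)) (m+n≤o⇒m≤o∸n (a * t * d) {d * c} (subst (_≤ a * l) (expand d c a t) (<⇒≤ dD<al))))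
  where
  c = angle a (b * r)
  d = l ∸ m
  D = c + a * t
  d>0 : 0 < d
  d>0 = m<n⇒0<n∸m m<l
  D>0 : 0 < D
  D>0 = ≤-trans (proj₁ (angle-spec a (b * r))) (m≤m+n c (a * t))
  dD<al : d * D < a * l
  dD<al = *-cancelʳ-< n (d * D) (a * l) (begin-strict
    d * D * n  ≡⟨ xy∙z≈xz∙y d D n ⟩
    d * n * D  <⟨ *-monoˡ-< D {{>-nonZero D>0}} dn<p ⟩
    p * D      ≤⟨ p*D≤aln ⟩
    a * l * n  ∎)
    where open ≤-Reasoning
  rearrange : ∀ t a d → t * (a * d) ≡ a * t * d
  rearrange = solve-∀
  expand : ∀ d c a t → d * (c + a * t) ≡ a * t * d + d * c
  expand = solve-∀

root⇒piece⊎tail : ∀ {l m a b r n p i} .{{_ : NonZero a}} → (p * r) % a ≡ 1 % a → 0 < b → m < l →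
  (l ∸ m) * n < p → p ∣ a * i + b → m * n < i → i ≤ l * n →
  (∃[ t ] t ≤ H l m a b r × T (inPiece l m a b r n p t)) ⊎ (∃[ u ] 1 ≤ u × u ≤ b × p ∣ a * l * n + u)
root⇒piece⊎tail {l} {m} {a} {b} {r} {n} {p} {i} pr≡1 b>0 m<l dn<p (divides k ai+b≡kp) mn<i i≤ln
  with cofactor≡angle+a*t b r p i k pr≡1 b>0 (trans ai+b≡kp (*-comm k p)) | p * k ≤? a * l * n
... | t , k≡c+at | yes pk≤aln = inj₁ (t , index≤H b r t m<l dn<p upper , from T-∧ (<⇒<ᵇ lower , ≤⇒≤ᵇ upper))
  where
  upper : p * (angle a (b * r) + a * t) ≤ a * l * n
  upper = subst (λ x → p * x ≤ a * l * n) k≡c+at pk≤aln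
  lower : a * m * n < p * (angle a (b * r) + a * t)
  lower = begin-strict
    a * m * n    ≡⟨ *-assoc a m n ⟩
    a * (m * n)  <⟨ *-monoʳ-< a mn<i ⟩
    a * i        ≤⟨ m≤m+n (a * i) b ⟩
    a * i + b    ≡⟨ trans ai+b≡kp (*-comm k p) ⟩
    p * k        ≡⟨ cong (p *_) k≡c+at ⟩
    p * (angle a (b * r) + a * t) ∎
    where open ≤-Reasoning
... | _ | no pk≰aln = inj₂ (u , m<n⇒0<n∸m aln<pk , u≤b , divides k (trans (m+[n∸m]≡n (<⇒≤ aln<pk)) (*-comm p k)))
  where
  aln<pk = ≰⇒> pk≰aln
  u = p * k ∸ a * l * n
  u≤b : u ≤ b
  u≤b = begin
    p * k ∸ a * l * n            ≡⟨ cong (_∸ a * l * n) (trans (*-comm p k) (sym ai+b≡kp)) ⟩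
    (a * i + b) ∸ a * l * n      ≤⟨ ∸-monoˡ-≤ (a * l * n) (+-monoˡ-≤ b ai≤aln) ⟩
    (a * l * n + b) ∸ a * l * n  ≡⟨ m+n∸m≡n (a * l * n) b ⟩
    b                            ∎
    where
    open ≤-Reasoning
    ai≤aln : a * i ≤ a * l * n
    ai≤aln = ≤-trans (*-monoʳ-≤ a i≤ln) (≤-reflexive (sym (*-assoc a l n)))

-- Prime divisors of the values f(i)

common-divisor-of-shifts≤ : ∀ {p x c₁ c₂} → p ∣ x + c₁ → p ∣ x + c₂ → c₁ < c₂ → p ≤ c₂
common-divisor-of-shifts≤ {p} {x} {c₁} {c₂} p∣x+c₁ p∣x+c₂ c₁<c₂ =
  ≤-trans (∣⇒≤ {{>-nonZero (m<n⇒0<n∸m c₁<c₂)}} p∣c₂∸c₁) (m∸n≤m c₂ c₁)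
  where
  p∣c₂∸c₁ : p ∣ c₂ ∸ c₁
  p∣c₂∸c₁ = ∣m+n∣m⇒∣n (subst (p ∣_) x+c₂≡ p∣x+c₂) p∣x+c₁
    where
    x+c₂≡ : x + c₂ ≡ x + c₁ + (c₂ ∸ c₁)
    x+c₂≡ = trans (cong (x +_) (sym (m+[n∸m]≡n (<⇒≤ c₁<c₂)))) (sym (+-assoc x c₁ (c₂ ∸ c₁)))

-- A common divisor of a₁ i + b₁ and a₂ i + b₂ divides a₁ b₂ − a₂ b₁.
common-divisor≤cross : ∀ {p a₁ b₁ a₂ b₂} i → a₁ * b₂ ≢ a₂ * b₁ →
  p ∣ a₁ * i + b₁ → p ∣ a₂ * i + b₂ → p ≤ a₁ * b₂ + a₂ * b₁
common-divisor≤cross {p} {a₁} {b₁} {a₂} {b₂} i a₁b₂≢a₂b₁ p∣₁ p∣₂ =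
  cross (subst (p ∣_) (scale₁ a₁ a₂ i b₁) (∣-trans p∣₁ (n∣m*n a₂)))
        (subst (p ∣_) (scale₂ a₁ a₂ i b₂) (∣-trans p∣₂ (n∣m*n a₁)))
  where
  scale₁ : ∀ a₁ a₂ i b₁ → a₂ * (a₁ * i + b₁) ≡ a₁ * a₂ * i + a₂ * b₁
  scale₁ = solve-∀
  scale₂ : ∀ a₁ a₂ i b₂ → a₁ * (a₂ * i + b₂) ≡ a₁ * a₂ * i + a₁ * b₂
  scale₂ = solve-∀
  cross : p ∣ a₁ * a₂ * i + a₂ * b₁ → p ∣ a₁ * a₂ * i + a₁ * b₂ → p ≤ a₁ * b₂ + a₂ * b₁
  cross p∣x+a₂b₁ p∣x+a₁b₂ with <-cmp (a₂ * b₁) (a₁ * b₂)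
  ... | tri≈ _ eq _ = ⊥-elim (a₁b₂≢a₂b₁ (sym eq))
  ... | tri< lt _ _ = ≤-trans (common-divisor-of-shifts≤ p∣x+a₂b₁ p∣x+a₁b₂ lt) (m≤m+n (a₁ * b₂) (a₂ * b₁))
  ... | tri> _ _ gt = ≤-trans (common-divisor-of-shifts≤ p∣x+a₁b₂ p∣x+a₂b₁ gt) (m≤n+m (a₂ * b₁) (a₁ * b₂))

modN≡% : ∀ q x .{{_ : NonZero q}} → modN q x ≡ x % q
modN≡% (suc _) x = refl

module Setting (l m a₁ b₁ a₂ b₂ : ℕ) .{{_ : NonZero a₁}} .{{_ : NonZero a₂}}
               (m<l : m < l) (b₁>0 : 0 < b₁) (b₂>0 : 0 < b₂) where

  q = lcm a₁ a₂
  instance q≢0 = lcm≢0 a₁ a₂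
  d = l ∸ m
  B = b₁ + b₂
  F = f a₁ b₁ a₂ b₂

  a₁∣q : a₁ ∣ q
  a₁∣q = m∣lcm[m,n] a₁ a₂
  a₂∣q : a₂ ∣ q
  a₂∣q = n∣lcm[m,n] a₁ a₂

  F>0 : ∀ i → 0 < F i
  F>0 i = m*n>0 (<-≤-trans b₁>0 (m≤n+m b₁ (a₁ * i))) (<-≤-trans b₂>0 (m≤n+m b₂ (a₂ * i)))

  factor₁∣F : ∀ i → a₁ * i + b₁ ∣ F i
  factor₁∣F i = m∣m*n (a₂ * i + b₂)
  factor₂∣F : ∀ i → a₂ * i + b₂ ∣ F i
  factor₂∣F i = n∣m*n (a₁ * i + b₁)

  inPieces : ∀ a b r n p → Bool
  inPieces a b r n p = any (inPiece l m a b r n p) (applyUpTo (λ i → i) (suc (H l m a b r)))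

  in𝒫 : ℕ → ℕ → ℕ → Bool
  in𝒫 n r′ p = inP l m a₁ b₁ a₂ b₂ n r′ p

  isUnit : ℕ → Bool
  isUnit r′ = gcd r′ q ≡ᵇ 1

  -- primeProd regrouped prime by prime; r′ ≡ p (mod q) is unique, so each weight is 1 or p.
  weight : ℕ → ℕ → ℕ
  weight n p = product (map (λ r′ → if isUnit r′ ∧ in𝒫 n r′ p then p else 1) (applyUpTo suc q))

  primeProd≡∏weight : ∀ n → primeProd l m a₁ b₁ a₂ b₂ n ≡ product (map (weight n) (interval 0 (bound l m a₁ a₂ n)))
  primeProd≡∏weight n = trans (product-filter-swap isUnit (in𝒫 n) (applyUpTo suc q) (applyUpTo suc (bound l m a₁ a₂ n)))
                              (cong (product ∘ map (weight n)) (applyUpTo≡interval 0 (bound l m a₁ a₂ n)))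

  in𝒫⁻ : ∀ {n r′ p} → T (in𝒫 n r′ p) → Prime p × p % q ≡ r′ % q × T (inUnion l m a₁ b₁ a₂ b₂ (invMod q r′) n p)
  in𝒫⁻ {n} {r′} {p} t with to (T-∧ {⌊ prime? p ⌋}) t
  ... | isPrime , rest with to (T-∧ {modN q p ≡ᵇ modN q r′}) rest
  ...   | p≡r′ , inU = toWitness isPrime , trans (sym (modN≡% q p)) (trans (≡ᵇ⇒≡ _ _ p≡r′) (modN≡% q r′)) , inU

  in𝒫⁺ : ∀ {n r′ p} → Prime p → p % q ≡ r′ % q → T (inUnion l m a₁ b₁ a₂ b₂ (invMod q r′) n p) → T (in𝒫 n r′ p)
  in𝒫⁺ {n} {r′} {p} pp p≡r′ inU =
    from (T-∧ {⌊ prime? p ⌋}) (fromWitness pp , from (T-∧ {modN q p ≡ᵇ modN q r′}) (≡⇒≡ᵇ _ _ p≡ᵇr′ , inU))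
    where
    p≡ᵇr′ : modN q p ≡ modN q r′
    p≡ᵇr′ = trans (modN≡% q p) (trans p≡r′ (sym (modN≡% q r′)))

  residue-unique : ∀ {n p x y} → x ∈ interval 0 q → y ∈ interval 0 q →
    T (isUnit x ∧ in𝒫 n x p) → T (isUnit y ∧ in𝒫 n y p) → x ≡ y
  residue-unique {n} {p} {x} {y} x∈ y∈ tx ty with ∈-interval⁻ x∈ | ∈-interval⁻ y∈
  ... | x>0 , x≤q | y>0 , y≤q = %-injective-[1,n] x>0 x≤q y>0 y≤q
    (trans (sym (proj₁ (proj₂ (in𝒫⁻ {n} {x} {p} (proj₂ (to (T-∧ {isUnit x}) tx))))))
           (proj₁ (proj₂ (in𝒫⁻ {n} {y} {p} (proj₂ (to (T-∧ {isUnit y}) ty))))))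

  weight≡1⊎p : ∀ n p → weight n p ≡ 1 ⊎ (weight n p ≡ p × ∃[ r′ ] T (isUnit r′ ∧ in𝒫 n r′ p))
  weight≡1⊎p n p with product-map-if-unique (λ r′ → isUnit r′ ∧ in𝒫 n r′ p) p 0 q (residue-unique {n} {p})
  ... | inj₁ w≡1 = inj₁ (trans (cong (product ∘ map _) (applyUpTo≡interval 0 q)) w≡1)
  ... | inj₂ (w≡p , r′ , _ , t) = inj₂ (trans (cong (product ∘ map _) (applyUpTo≡interval 0 q)) w≡p , r′ , t)

  p∣weight : ∀ {n p r′} → 1 ≤ r′ → r′ ≤ q → T (isUnit r′ ∧ in𝒫 n r′ p) → p ∣ weight n p
  p∣weight {n} {p} {r′} 1≤r′ r′≤q t = subst (_∣ weight n p) (if-true (isUnit r′ ∧ in𝒫 n r′ p) t)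
    (∈⇒∣product (∈-map⁺ (λ r → if isUnit r ∧ in𝒫 n r p then p else 1) (∈-applyUpTo-suc 1≤r′ r′≤q)))
    where
    if-true : ∀ b → T b → (if b then p else 1) ≡ p
    if-true true _ = refl

  cross = a₁ * b₂ + a₂ * b₁

  K₁ K₂ K : ℕ → ℕ
  K₁ c = (c * c * (c * c) * 2 ^ 40) ^ (2 * c)
  K₂ c = (c * c * 16) ^ B
  K  c = K₁ c * K₂ c

  module AtScale (n : ℕ) (n>0 : 0 < n) (B≤n : B ≤ n) where

    L = lcmF l m a₁ b₁ a₂ b₂ n
    P = primeProd l m a₁ b₁ a₂ b₂ n
    -- A prime of P whose root i of aⱼ i + bⱼ falls just below the window (mn, ln] divides W.
    W = product (map F (range (m * n ∸ B) (m * n)))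

    mn≤ln : m * n ≤ l * n
    mn≤ln = *-monoˡ-≤ n (<⇒≤ m<l)

    mn+dn≡ln : m * n + d * n ≡ l * n
    mn+dn≡ln = trans (cong (m * n +_) (*-distribʳ-∸ n l m)) (m+[n∸m]≡n mn≤ln)

    n≤dn : n ≤ d * n
    n≤dn = m≤n*m n d {{>-nonZero (m<n⇒0<n∸m m<l)}}

    ∈-range⁺ : ∀ {lo hi i} → lo ≤ hi → lo < i → i ≤ hi → i ∈ range lo hi
    ∈-range⁺ {lo} {hi} {i} lo≤hi lo<i i≤hi =
      subst (i ∈_) (sym (range≡interval lo hi)) (∈-interval⁺ lo<i (subst (i ≤_) (sym (m+[n∸m]≡n lo≤hi)) i≤hi))

    F∣L : ∀ {i} → m * n < i → i ≤ l * n → F i ∣ L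
    F∣L mn<i i≤ln = ∈⇒∣lcmList (∈-map⁺ F (∈-range⁺ mn≤ln mn<i i≤ln))

    F∣W : ∀ {i} → m * n ∸ B < i → i ≤ m * n → F i ∣ W
    F∣W lo<i i≤mn = ∈⇒∣product (∈-map⁺ F (∈-range⁺ (m∸n≤m (m * n) B) lo<i i≤mn))

    small-prime∣L : ∀ {a} b {p} .{{_ : NonZero p}} → Coprime a p → p ≤ d * n → (∀ i → a * i + b ∣ F i) → p ∣ L
    small-prime∣L b a⊥p p≤dn factor∣F with ∃-root-in-window b (m * n) (d * n) a⊥p p≤dn
    ... | i , mn<i , i≤ , p∣ai+b = ∣-trans p∣ai+b (∣-trans (factor∣F i) (F∣L mn<i (subst (i ≤_) mn+dn≡ln i≤)))

    piece-prime∣LW : ∀ {a} b r {p} t .{{_ : NonZero a}} .{{_ : NonZero p}} → Coprime p q → a ∣ q → b ≤ B →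
      (∀ i → a * i + b ∣ F i) → (p * r) % a ≡ 1 % a → T (inPiece l m a b r n p t) → p ∣ L * W
    piece-prime∣LW {a} b r {p} t p⊥q a∣q b≤B factor∣F pr≡1 inPc with p ≤? d * n
    ... | yes p≤dn = ∣-trans (small-prime∣L b (Coprimality.sym (coprime-∣ʳ p⊥q a∣q)) p≤dn factor∣F) (m∣m*n W)
    ... | no  p≰dn with to (T-∧ {a * m * n <ᵇ p * (angle a (b * r) + a * t)}) inPc
    ...   | lower , upper with piece⇒root b r p t (m * n) (l * n) B pr≡1 b<p b≤B
                                 (subst (_< p * D) (*-assoc a m n) (<ᵇ⇒< (a * m * n) (p * D) lower))
                                 (subst (p * D ≤_) (*-assoc a l n) (≤ᵇ⇒≤ (p * D) (a * l * n) upper))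
      where
      D = angle a (b * r) + a * t
      b<p : b < p
      b<p = ≤-<-trans (≤-trans b≤B (≤-trans B≤n n≤dn)) (≰⇒> p≰dn)
    ...     | i , lo<i , i≤ln , p∣ai+b with i ≤? m * n
    ...       | yes i≤mn = ∣-trans p∣ai+b (∣-trans (factor∣F i) (∣-trans (F∣W lo<i i≤mn) (n∣m*n L)))
    ...       | no  i≰mn = ∣-trans p∣ai+b (∣-trans (factor∣F i) (∣-trans (F∣L (≰⇒> i≰mn) i≤ln) (m∣m*n W)))

    pieces-prime∣LW : ∀ {a} b r {p} .{{_ : NonZero a}} .{{_ : NonZero p}} → Coprime p q → a ∣ q → b ≤ B →
      (∀ i → a * i + b ∣ F i) → (p * r) % q ≡ 1 % q → T (inPieces a b r n p) → p ∣ L * W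
    pieces-prime∣LW {a} b r {p} p⊥q a∣q b≤B factor∣F pr≡1 inPcs =
      piece-prime∣LW b r (proj₁ found) p⊥q a∣q b≤B factor∣F (%-cong-∣ a∣q pr≡1) (proj₂ found)
      where found = satisfied (any⁻ (inPiece l m a b r n p) (applyUpTo (λ i → i) (suc (H l m a b r))) inPcs)

    inUnion⇒∣LW : ∀ {p} r → Prime p → Coprime p q → (p * r) % q ≡ 1 % q →
      T (inUnion l m a₁ b₁ a₂ b₂ r n p) → p ∣ L * W
    inUnion⇒∣LW {p} r pp p⊥q pr≡1 inU with to (T-∨ {(0 <ᵇ p) ∧ (p ≤ᵇ d * n)}) inU
    ... | inj₁ small =
      ∣-trans (small-prime∣L b₁ {{prime⇒nonZero pp}} (Coprimality.sym (coprime-∣ʳ p⊥q a₁∣q)) p≤dn factor₁∣F) (m∣m*n W)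
      where
      p≤dn = ≤ᵇ⇒≤ p (d * n) (proj₂ (to (T-∧ {0 <ᵇ p}) small))
    ... | inj₂ pieces = Sum.[ pieces-prime∣LW b₁ r p⊥q a₁∣q (m≤m+n b₁ b₂) factor₁∣F pr≡1
                            , pieces-prime∣LW b₂ r p⊥q a₂∣q (m≤n+m b₂ b₁) factor₂∣F pr≡1
                            ] (to (T-∨ {inPieces a₁ b₁ r n p}) pieces)
      where instance p≢0 = prime⇒nonZero pp

    admissible⇒∣LW : ∀ {r′ p} → T (isUnit r′ ∧ in𝒫 n r′ p) → p ∣ L * W
    admissible⇒∣LW {r′} {p} t = inUnion⇒∣LW r pp p⊥q pr≡1 inU
      where
      r′-unit = proj₁ (to (T-∧ {isUnit r′}) t)
      decoded = in𝒫⁻ {n} {r′} {p} (proj₂ (to (T-∧ {isUnit r′}) t))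
      pp = proj₁ decoded
      p≡r′ = proj₁ (proj₂ decoded)
      inU = proj₂ (proj₂ decoded)
      r′⊥q : Coprime r′ q
      r′⊥q = gcd≡1⇒coprime (≡ᵇ⇒≡ (gcd r′ q) 1 r′-unit)
      p⊥q : Coprime p q
      p⊥q = coprime-%-cong p≡r′ r′⊥q
      r = invMod q r′
      pr≡1 : (p * r) % q ≡ 1 % q
      pr≡1 = trans (%-congʳ-* {q} p r′ r p≡r′) (trans (cong (_% q) (*-comm r′ r)) (invMod-spec r′ r′⊥q))

    L>0 : 0 < L
    L>0 = lcmList>0 (map F (range (m * n) (l * n))) λ x∈ → case ∈-map⁻ F x∈ of λ { (i , _ , refl) → F>0 i }

    W>0 : 0 < W
    W>0 = product-map-pos F (range (m * n ∸ B) (m * n)) (λ {i} _ → F>0 i)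

    P∣LW : P ∣ L * W
    P∣LW = subst (_∣ L * W) (sym (primeProd≡∏weight n))
      (product-map-interval-primes∣ (L * W) (weight n) 0 (bound l m a₁ a₂ n) (λ p _ _ → select p))
      where
      select : ∀ p → weight n p ≡ 1 ⊎ (weight n p ≡ p × Prime p × p ∣ L * W)
      select p with weight≡1⊎p n p
      ... | inj₁ w≡1 = inj₁ w≡1
      ... | inj₂ (w≡p , r′ , t) =
        inj₂ (w≡p , proj₁ (in𝒫⁻ {n} {r′} {p} (proj₂ (to (T-∧ {isUnit r′}) t))) , admissible⇒∣LW {r′} t)

    P≤LW : P ≤ L * W
    P≤LW = ∣⇒≤ {{>-nonZero (m*n>0 L>0 W>0)}} P∣LW

    X = (a₁ + a₂) * (l * n) + B
    Z = X * X
    -- A large prime with aⱼ i + bⱼ = p k and p k > aⱼ l n divides E.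
    E = product (map (λ u → (a₁ * l * n + u) * (a₂ * l * n + u)) (interval 0 B))

    factor₁≤X : ∀ {i} → i ≤ l * n → a₁ * i + b₁ ≤ X
    factor₁≤X i≤ln = +-mono-≤ (≤-trans (*-monoʳ-≤ a₁ i≤ln) (*-monoˡ-≤ (l * n) (m≤m+n a₁ a₂))) (m≤m+n b₁ b₂)

    factor₂≤X : ∀ {i} → i ≤ l * n → a₂ * i + b₂ ≤ X
    factor₂≤X i≤ln = +-mono-≤ (≤-trans (*-monoʳ-≤ a₂ i≤ln) (*-monoˡ-≤ (l * n) (m≤n+m a₂ a₁))) (m≤n+m b₂ b₁)

    F≤Z : ∀ {i} → i ≤ l * n → F i ≤ Z
    F≤Z i≤ln = *-mono-≤ (factor₁≤X i≤ln) (factor₂≤X i≤ln)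

    Z>0 : 0 < Z
    Z>0 = ≤-trans (F>0 0) (F≤Z z≤n)

    X≤bound : X ≤ bound l m a₁ a₂ n
    X≤bound = +-mono-≤ (≤-reflexive (sym (*-assoc (a₁ + a₂) l n))) (≤-trans B≤n n≤dn)

    admissible⇒∣P : ∀ {r′ p} → 1 ≤ r′ → r′ ≤ q → Prime p → p ≤ bound l m a₁ a₂ n → T (isUnit r′ ∧ in𝒫 n r′ p) → p ∣ P
    admissible⇒∣P {r′} {p} 1≤r′ r′≤q pp p≤bound t = subst (p ∣_) (sym (primeProd≡∏weight n))
      (∣-trans (p∣weight {n} 1≤r′ r′≤q t) (∈⇒∣product (∈-map⁺ (weight n) (∈-interval⁺ (<-trans z<s (prime>1 pp)) p≤bound))))

    module LcmDivisor (Y : ℕ) (q≤Y : q ≤ Y) (cross≤Y : cross ≤ Y) (X≤Y² : X ≤ Y * Y)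
                 (a₁b₂≢a₂b₁ : a₁ * b₂ ≢ a₂ * b₁) where

      M = P * (smoothPart Y Z * E)

      large-square∤ : ∀ {p v} → Y < p → 0 < v → v ≤ X → ¬ p * p ∣ v
      large-square∤ Y<p v>0 v≤X p²∣v = <⇒≱ (*-mono-< Y<p Y<p) (≤-trans (∣⇒≤ {{>-nonZero v>0}} p²∣v) (≤-trans v≤X X≤Y²))

      no-common-large-prime : ∀ {p i} → Y < p → p ∣ a₁ * i + b₁ → p ∣ a₂ * i + b₂ → ⊥
      no-common-large-prime {p} {i} Y<p p∣₁ p∣₂ =
        <⇒≱ Y<p (≤-trans (common-divisor≤cross {p} {a₁} {b₁} {a₂} {b₂} i a₁b₂≢a₂b₁ p∣₁ p∣₂) cross≤Y)

      large-prime-square-free : ∀ {p i} → Prime p → Y < p → p * p ∣ F i → i ≤ l * n → ⊥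
      large-prime-square-free {p} {i} pp Y<p p²∣F i≤ln with euclidsLemma (a₁ * i + b₁) (a₂ * i + b₂) pp (∣-trans (m∣m*n p) p²∣F)
      ... | inj₁ p∣₁ with p ∣? (a₂ * i + b₂)
      ...   | yes p∣₂ = no-common-large-prime Y<p p∣₁ p∣₂
      ...   | no  p∤₂ = large-square∤ Y<p (<-≤-trans b₁>0 (m≤n+m b₁ (a₁ * i))) (factor₁≤X i≤ln)
                          (coprime-divisor (coprime-*ˡ p⊥ p⊥) (subst (p * p ∣_) (*-comm (a₁ * i + b₁) _) p²∣F))
        where p⊥ = prime∤⇒coprime pp p∤₂
      large-prime-square-free {p} {i} pp Y<p p²∣F i≤ln | inj₂ p∣₂ with p ∣? (a₁ * i + b₁)
      ...   | yes p∣₁ = no-common-large-prime Y<p p∣₁ p∣₂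
      ...   | no  p∤₁ = large-square∤ Y<p (<-≤-trans b₂>0 (m≤n+m b₂ (a₂ * i))) (factor₂≤X i≤ln)
                          (coprime-divisor (coprime-*ˡ p⊥ p⊥) p²∣F)
        where p⊥ = prime∤⇒coprime pp p∤₁

      small-prime-power∣smooth : ∀ {p k i} → Prime p → p ≤ Y → p ^ k ∣ F i → i ≤ l * n → p ^ k ∣ smoothPart Y Z
      small-prime-power∣smooth {p} {k} {i} pp p≤Y pᵏ∣F i≤ln =
        ∣-trans (^-monoʳ-∣ p k≤e) (subst (_∣ smoothPart Y Z) (primePowerUpTo-prime Z pp)
          (∈⇒∣product (∈-map⁺ (primePowerUpTo Z) (∈-interval⁺ (<-trans z<s (prime>1 pp)) p≤Y))))
        where
        k≤e : k ≤ ilog p Z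
        k≤e = ilog-greatest (prime>1 pp) Z>0 (≤-trans (∣⇒≤ {{>-nonZero (F>0 i)}} pᵏ∣F) (F≤Z i≤ln))

      module LargePrime {p : ℕ} (pp : Prime p) (Y<p : Y < p) where

        r′ = angle q p
        r′-spec = angle-spec q p
        r = invMod q r′

        r′⊥q : Coprime r′ q
        r′⊥q = coprime-%-cong (proj₂ (proj₂ r′-spec)) (prime⇒coprime pp (≤-<-trans q≤Y Y<p))

        pr≡1 : (p * r) % q ≡ 1 % q
        pr≡1 = trans (%-congʳ-* {q} p r′ r (sym (proj₂ (proj₂ r′-spec))))
                     (trans (cong (_% q) (*-comm r′ r)) (invMod-spec r′ r′⊥q))

        inUnion⇒∣P : p ≤ X → T (inUnion l m a₁ b₁ a₂ b₂ r n p) → p ∣ P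
        inUnion⇒∣P p≤X inU = admissible⇒∣P (proj₁ r′-spec) (proj₁ (proj₂ r′-spec)) pp (≤-trans p≤X X≤bound)
          (from (T-∧ {isUnit r′}) (≡⇒≡ᵇ _ _ (coprime⇒gcd≡1 r′⊥q) , in𝒫⁺ pp (sym (proj₂ (proj₂ r′-spec))) inU))

      large-prime∣P⊎E : ∀ {a} b {p i} .{{_ : NonZero a}} → Prime p → Y < p → a ∣ q → 0 < b → b ≤ B →
        (∀ r → T (inPieces a b r n p) → T (inUnion l m a₁ b₁ a₂ b₂ r n p)) →
        (∀ u → a * l * n + u ∣ (a₁ * l * n + u) * (a₂ * l * n + u)) →
        p ∣ a * i + b → a * i + b ≤ X → m * n < i → i ≤ l * n → p ∣ P ⊎ p ∣ E
      large-prime∣P⊎E {a} b {p} {i} pp Y<p a∣q b>0 b≤B piece⇒inUnion factor∣E p∣ai+b ai+b≤X mn<i i≤ln =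
        cases (p ≤? d * n)
        where
        open LargePrime pp Y<p
        p≤X : p ≤ X
        p≤X = ≤-trans (∣⇒≤ {{>-nonZero (<-≤-trans b>0 (m≤n+m b (a * i)))}} p∣ai+b) ai+b≤X
        cases : Dec (p ≤ d * n) → p ∣ P ⊎ p ∣ E
        cases (yes p≤dn) = inj₁ (inUnion⇒∣P p≤X (from (T-∨ {(0 <ᵇ p) ∧ (p ≤ᵇ d * n)})
          (inj₁ (from (T-∧ {0 <ᵇ p}) (<⇒<ᵇ (<-trans z<s (prime>1 pp)) , ≤⇒≤ᵇ p≤dn)))))
        cases (no p≰dn) = Sum.map
          (λ (t , t≤H , inPc) → inUnion⇒∣P p≤X (piece⇒inUnion r (any⁺ _ (lose (∈-applyUpTo⁺ (λ i → i) (s≤s t≤H)) inPc))))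
          (λ (u , 1≤u , u≤b , p∣aln+u) → ∣-trans p∣aln+u (∣-trans (factor∣E u)
            (∈⇒∣product (∈-map⁺ (λ u → (a₁ * l * n + u) * (a₂ * l * n + u)) (∈-interval⁺ 1≤u (≤-trans u≤b b≤B))))))
          (root⇒piece⊎tail (%-cong-∣ a∣q pr≡1) b>0 m<l (≰⇒> p≰dn) p∣ai+b mn<i i≤ln)

      P⊎E⇒∣M : ∀ {p} → p ∣ P ⊎ p ∣ E → p ∣ M
      P⊎E⇒∣M (inj₁ p∣P) = ∣-trans p∣P (m∣m*n (smoothPart Y Z * E))
      P⊎E⇒∣M (inj₂ p∣E) = ∣-trans p∣E (∣-trans (n∣m*n (smoothPart Y Z)) (n∣m*n P))

      prime-power∣M : ∀ {i} → m * n < i → i ≤ l * n → ∀ p k → Prime p → p ^ k ∣ F i → p ^ k ∣ M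
      prime-power∣M {i} mn<i i≤ln p k pp pᵏ∣F with p ≤? Y
      ... | yes p≤Y = ∣-trans (small-prime-power∣smooth {k = k} pp p≤Y pᵏ∣F i≤ln) (∣-trans (m∣m*n E) (n∣m*n P))
      ... | no  p≰Y with k
      ...   | zero  = 1∣ M
      ...   | suc (suc k′) =
        ⊥-elim (large-prime-square-free pp (≰⇒> p≰Y) (∣-trans (divides (p ^ k′) (pp·x≡x·pp p (p ^ k′))) pᵏ∣F) i≤ln)
        where
        pp·x≡x·pp : ∀ p x → p * (p * x) ≡ x * (p * p)
        pp·x≡x·pp = solve-∀
      ...   | suc zero with euclidsLemma (a₁ * i + b₁) (a₂ * i + b₂) pp (subst (_∣ F i) (*-identityʳ p) pᵏ∣F)
      ...     | inj₁ p∣₁ = subst (_∣ M) (sym (*-identityʳ p)) (P⊎E⇒∣M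
                  (large-prime∣P⊎E b₁ pp (≰⇒> p≰Y) a₁∣q b₁>0 (m≤m+n b₁ b₂) inject₁ (λ u → m∣m*n (a₂ * l * n + u))
                                   p∣₁ (factor₁≤X i≤ln) mn<i i≤ln))
        where
        inject₁ : ∀ r → T (inPieces a₁ b₁ r n p) → T (inUnion l m a₁ b₁ a₂ b₂ r n p)
        inject₁ r t = from (T-∨ {(0 <ᵇ p) ∧ (p ≤ᵇ d * n)}) (inj₂ (from (T-∨ {inPieces a₁ b₁ r n p}) (inj₁ t)))
      ...     | inj₂ p∣₂ = subst (_∣ M) (sym (*-identityʳ p)) (P⊎E⇒∣M
                  (large-prime∣P⊎E b₂ pp (≰⇒> p≰Y) a₂∣q b₂>0 (m≤n+m b₂ b₁) inject₂ (λ u → n∣m*n (a₁ * l * n + u))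
                                   p∣₂ (factor₂≤X i≤ln) mn<i i≤ln))
        where
        inject₂ : ∀ r → T (inPieces a₂ b₂ r n p) → T (inUnion l m a₁ b₁ a₂ b₂ r n p)
        inject₂ r t = from (T-∨ {(0 <ᵇ p) ∧ (p ≤ᵇ d * n)}) (inj₂ (from (T-∨ {inPieces a₁ b₁ r n p}) (inj₂ t)))

      L∣M : L ∣ M
      L∣M = lcmList-least (map F (range (m * n) (l * n))) λ {x} x∈ → case ∈-map⁻ F x∈ of λ where
        (i , i∈ , refl) → let (mn<i , i≤) = ∈-interval⁻ (subst (i ∈_) (range≡interval (m * n) (l * n)) i∈) in
          ∣-by-prime-powers (F i) M (F>0 i) (prime-power∣M mn<i (subst (i ≤_) (m+[n∸m]≡n mn≤ln) i≤))

      M>0 : 0 < M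
      M>0 = m*n>0 P>0 (m*n>0 (product-map-pos (primePowerUpTo Z) (interval 0 Y) (λ {x} _ → primePowerUpTo>0 Z x)) E>0)
        where
        P>0 : 0 < P
        P>0 = subst (0 <_) (sym (primeProd≡∏weight n)) (product-map-pos (weight n) (interval 0 (bound l m a₁ a₂ n)) weight>0)
          where
          weight>0 : ∀ {p} → p ∈ interval 0 (bound l m a₁ a₂ n) → 0 < weight n p
          weight>0 {p} p∈ with weight≡1⊎p n p
          ... | inj₁ w≡1       = subst (0 <_) (sym w≡1) z<s
          ... | inj₂ (w≡p , _) = subst (0 <_) (sym w≡p) (proj₁ (∈-interval⁻ p∈))
        ln>0 : ∀ a .{{_ : NonZero a}} → 0 < a * l * n
        ln>0 a = m*n>0 (m*n>0 (>-nonZero⁻¹ a) (<-≤-trans z<s m<l)) n>0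
        E>0 : 0 < E
        E>0 = product-map-pos _ (interval 0 B) λ {u} _ →
          m*n>0 (<-≤-trans (ln>0 a₁) (m≤m+n _ u)) (<-≤-trans (ln>0 a₂) (m≤m+n _ u))

      L≤M : L ≤ M
      L≤M = ∣⇒≤ {{>-nonZero M>0}} L∣M

    E≤Z^B : E ≤ Z ^ B
    E≤Z^B = subst (E ≤_) (cong (Z ^_) (length-interval 0 B)) (product-map-≤-^ _ Z (interval 0 B) factor≤Z)
      where
      factor≤Z : ∀ {u} → u ∈ interval 0 B → (a₁ * l * n + u) * (a₂ * l * n + u) ≤ Z
      factor≤Z u∈ = *-mono-≤ (+-mono-≤ (≤-trans (≤-reflexive (*-assoc a₁ l n)) (*-monoˡ-≤ (l * n) (m≤m+n a₁ a₂))) u≤B)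
                             (+-mono-≤ (≤-trans (≤-reflexive (*-assoc a₂ l n)) (*-monoˡ-≤ (l * n) (m≤n+m a₂ a₁))) u≤B)
        where u≤B = proj₂ (∈-interval⁻ u∈)

    W≤Z^B : W ≤ Z ^ B
    W≤Z^B = ≤-trans (product-map-≤-^ F Z (range (m * n ∸ B) (m * n)) F≤Z′) (^-monoʳ-≤ Z {{>-nonZero Z>0}} length≤B)
      where
      length≤B : length (range (m * n ∸ B) (m * n)) ≤ B
      length≤B = subst (_≤ B) (sym (trans (cong length (range≡interval (m * n ∸ B) (m * n))) (length-interval _ _)))
        (m≤n+o⇒m∸n≤o (m * n) (m * n ∸ B) (subst (m * n ≤_) (+-comm B (m * n ∸ B)) (m≤n+m∸n (m * n) B)))
      F≤Z′ : ∀ {i} → i ∈ range (m * n ∸ B) (m * n) → F i ≤ Z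
      F≤Z′ {i} i∈ = F≤Z (≤-trans (subst (i ≤_) (m+[n∸m]≡n (m∸n≤m (m * n) B)) i≤mn) mn≤ln)
        where i≤mn = proj₂ (∈-interval⁻ (subst (i ∈_) (range≡interval (m * n ∸ B) (m * n)) i∈))

    module WithConstant (c : ℕ) (c>0 : 0 < c) (base≤c : (a₁ + a₂) * l + B ≤ c) (q≤c : q ≤ c) (cross≤c : cross ≤ c) where

      s = proj₁ (sqrt-exists n)
      s²≤n = proj₁ (proj₂ (sqrt-exists n))
      n<[s+1]² = proj₂ (proj₂ (sqrt-exists n))

      s>0 : 0 < s
      s>0 with s | n<[s+1]²
      ... | zero  | n<1 = ⊥-elim (<⇒≱ n>0 (≤-pred n<1))
      ... | suc _ | _   = z<s

      X≤c[s+1]² : X ≤ c * (suc s * suc s)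
      X≤c[s+1]² = begin
        (a₁ + a₂) * (l * n) + B       ≤⟨ +-monoʳ-≤ ((a₁ + a₂) * (l * n)) (m≤m*n B n {{>-nonZero n>0}}) ⟩
        (a₁ + a₂) * (l * n) + B * n   ≡⟨ regroup (a₁ + a₂) l n B ⟩
        ((a₁ + a₂) * l + B) * n       ≤⟨ *-mono-≤ base≤c (<⇒≤ n<[s+1]²) ⟩
        c * (suc s * suc s)           ∎
        where
        open ≤-Reasoning
        regroup : ∀ a l n B → a * (l * n) + B * n ≡ (a * l + B) * n
        regroup = solve-∀

      instance c≢0 = >-nonZero c>0

      c⁴2⁴⁰≢0 : NonZero (c * c * (c * c) * 2 ^ 40)
      c⁴2⁴⁰≢0 = m*n≢0 (c * c * (c * c)) (2 ^ 40) {{m*n≢0 (c * c) (c * c) {{m*n≢0 c c}} {{m*n≢0 c c}}}}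

      K₁≢0 : NonZero (K₁ c)
      K₁≢0 = m^n≢0 (c * c * (c * c) * 2 ^ 40) (2 * c) {{c⁴2⁴⁰≢0}}

      K≢0 : NonZero (K c)
      K≢0 = m*n≢0 (K₁ c) (K₂ c) {{K₁≢0}} {{m^n≢0 (c * c * 16) B {{m*n≢0 (c * c) 16 {{m*n≢0 c c}}}}}}

      Z≤c²[s+1]⁴ : Z ≤ c * c * suc s ^ 4
      Z≤c²[s+1]⁴ = ≤-trans (*-mono-≤ X≤c[s+1]² X≤c[s+1]²) (≤-reflexive (regroup c s))
        where
        regroup : ∀ x y → x * (suc y * suc y) * (x * (suc y * suc y)) ≡ x * x * (suc y * (suc y * (suc y * (suc y * 1))))
        regroup = solve-∀

      Z^B≤K₂^s : Z ^ B ≤ K₂ c ^ s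
      Z^B≤K₂^s = begin
        Z ^ B                          ≤⟨ ^-monoˡ-≤ B Z≤[c²16]^s ⟩
        ((c * c * 16) ^ s) ^ B         ≡⟨ ^-*-assoc (c * c * 16) s B ⟩
        (c * c * 16) ^ (s * B)         ≡⟨ cong ((c * c * 16) ^_) (*-comm s B) ⟩
        (c * c * 16) ^ (B * s)         ≡⟨ ^-*-assoc (c * c * 16) B s ⟨
        K₂ c ^ s                         ∎
        where
        open ≤-Reasoning
        Z≤[c²16]^s : Z ≤ (c * c * 16) ^ s
        Z≤[c²16]^s = begin
          Z                            ≤⟨ Z≤c²[s+1]⁴ ⟩
          c * c * suc s ^ 4            ≤⟨ *-mono-≤ (subst (_≤ (c * c) ^ s) (^-identityʳ (c * c)) (^-monoʳ-≤ (c * c) {{m*n≢0 c c}} s>0))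
                                                    (^-monoˡ-≤ 4 {suc s} {2 ^ s} (n<2^n s)) ⟩
          (c * c) ^ s * (2 ^ s) ^ 4    ≡⟨ cong ((c * c) ^ s *_) (trans (^-*-assoc 2 s 4) (trans (cong (2 ^_) (*-comm s 4)) (sym (^-*-assoc 2 4 s)))) ⟩
          (c * c) ^ s * 16 ^ s         ≡⟨ ^-distrib-* (c * c) 16 s ⟨
          (c * c * 16) ^ s             ∎

      Y = c * suc s

      q≤Y : q ≤ Y
      q≤Y = ≤-trans q≤c (m≤m*n c (suc s))

      cross≤Y : cross ≤ Y
      cross≤Y = ≤-trans cross≤c (m≤m*n c (suc s))

      X≤Y² : X ≤ Y * Y
      X≤Y² = ≤-trans X≤c[s+1]² (≤-trans (*-monoˡ-≤ (suc s * suc s) (m≤m*n c c)) (≤-reflexive (regroup c s)))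
        where
        regroup : ∀ x y → x * x * (suc y * suc y) ≡ x * suc y * (x * suc y)
        regroup = solve-∀

      smooth≤K₁^s : smoothPart Y Z ≤ K₁ c ^ s
      smooth≤K₁^s = begin
        smoothPart Y Z                  ≤⟨ smoothPart≤ {Y} {Z} {c * c} {t} (m*n>0 c>0 c>0) t²≤Y Z>0 Z≤c²[t+1]⁸ ⟩
        (c * c * (c * c) * 2 ^ 40) ^ Y  ≤⟨ ^-monoʳ-≤ (c * c * (c * c) * 2 ^ 40) {{c⁴2⁴⁰≢0}} Y≤2cs ⟩
        (c * c * (c * c) * 2 ^ 40) ^ (2 * c * s) ≡⟨ ^-*-assoc (c * c * (c * c) * 2 ^ 40) (2 * c) s ⟨
        K₁ c ^ s                          ∎
        where
        open ≤-Reasoning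
        t = proj₁ (sqrt-exists Y)
        t²≤Y = proj₁ (proj₂ (sqrt-exists Y))
        s+1≤[t+1]² : suc s ≤ suc t * suc t
        s+1≤[t+1]² = ≤-trans (m≤n*m (suc s) c) (<⇒≤ (proj₂ (proj₂ (sqrt-exists Y))))
        Z≤c²[t+1]⁸ : Z ≤ c * c * suc t ^ 8
        Z≤c²[t+1]⁸ = begin
          Z                         ≤⟨ Z≤c²[s+1]⁴ ⟩
          c * c * suc s ^ 4         ≤⟨ *-monoʳ-≤ (c * c) (^-monoˡ-≤ 4 s+1≤[t+1]²) ⟩
          c * c * (suc t * suc t) ^ 4 ≡⟨ cong (c * c *_) (trans (^-distrib-* (suc t) (suc t) 4) (sym (^-distribˡ-+-* (suc t) 4 4))) ⟩
          c * c * suc t ^ 8         ∎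
        Y≤2cs : Y ≤ 2 * c * s
        Y≤2cs = ≤-trans (*-monoʳ-≤ c (+-monoˡ-≤ s s>0)) (≤-reflexive (regroup c s))
          where
          regroup : ∀ x y → x * (y + y) ≡ 2 * x * y
          regroup = solve-∀


      K^s≤K^isqrt : K c ^ s ≤ K c ^ isqrt n
      K^s≤K^isqrt = ^-monoʳ-≤ (K c) {{K≢0}} (isqrt≥ {t = s} s²≤n)

      upper : a₁ * b₂ ≢ a₂ * b₁ → L ≤ P * K c ^ isqrt n
      upper a₁b₂≢a₂b₁ = begin
        L                         ≤⟨ LcmDivisor.L≤M Y q≤Y cross≤Y X≤Y² a₁b₂≢a₂b₁ ⟩
        P * (smoothPart Y Z * E)  ≤⟨ *-monoʳ-≤ P (*-mono-≤ smooth≤K₁^s (≤-trans E≤Z^B Z^B≤K₂^s)) ⟩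
        P * (K₁ c ^ s * K₂ c ^ s)     ≡⟨ cong (P *_) (^-distrib-* (K₁ c) (K₂ c) s) ⟨
        P * K c ^ s                 ≤⟨ *-monoʳ-≤ P K^s≤K^isqrt ⟩
        P * K c ^ isqrt n           ∎
        where open ≤-Reasoning

      lower : P ≤ L * K c ^ isqrt n
      lower = begin
        P                  ≤⟨ P≤LW ⟩
        L * W              ≤⟨ *-monoʳ-≤ L (≤-trans W≤Z^B Z^B≤K₂^s) ⟩
        L * K₂ c ^ s       ≤⟨ *-monoʳ-≤ L (^-monoˡ-≤ s (m≤n*m (K₂ c) (K₁ c) {{K₁≢0}})) ⟩
        L * K c ^ s        ≤⟨ *-monoʳ-≤ L K^s≤K^isqrt ⟩
        L * K c ^ isqrt n  ∎
        where open ≤-Reasoning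

  c₀ = suc ((a₁ + a₂) * l + B + q + cross)

  module Estimates (n : ℕ) (n>0 : 0 < n) (B≤n : B ≤ n) = AtScale.WithConstant n n>0 B≤n c₀ z<s
    (m≤n⇒m≤1+n (≤-trans (m≤m+n ((a₁ + a₂) * l + B) q) (m≤m+n _ cross)))
    (m≤n⇒m≤1+n (≤-trans (m≤n+m q ((a₁ + a₂) * l + B)) (m≤m+n _ cross)))
    (m≤n⇒m≤1+n (m≤n+m cross ((a₁ + a₂) * l + B + q)))

lemma2p1 : (l m a1 b1 a2 b2 : ℕ) → m < l →
    0 < a1 → 0 < b1 → 0 < a2 → 0 < b2 →
    gcd a1 b1 ≡ 1 → gcd a2 b2 ≡ 1 → a1 * b2 ≢ a2 * b1 →
    -- log lcm = Σ log p + O(√n), in exponentiated form: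
    -- ∃ K N, ∀ n ≥ N,  L ≤ P · K^⌊√n⌋  and  P ≤ L · K^⌊√n⌋
    ∃[ K ] ∃[ N ] ((n : ℕ) → 0 < n → N ≤ n →
      (lcmF l m a1 b1 a2 b2 n ≤ primeProd l m a1 b1 a2 b2 n * K ^ isqrt n)
      × (primeProd l m a1 b1 a2 b2 n ≤ lcmF l m a1 b1 a2 b2 n * K ^ isqrt n))
lemma2p1 l m a1 b1 a2 b2 m<l a1>0 b1>0 a2>0 b2>0 _ _ a1b2≢a2b1 =
  K c₀ , B , λ n n>0 B≤n → Estimates.upper n n>0 B≤n a1b2≢a2b1 , Estimates.lower n n>0 B≤n
  where open Setting l m a1 b1 a2 b2 {{>-nonZero a1>0}} {{>-nonZero a2>0}} m<l b1>0 b2>0
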